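{- Let $n$ and $2\le k\le n$ be integers. There exist $n$ points $p_1,\dots,p_n\in\{0,1\}^d$ with $d=O(k\log(n/k))$ such that for every $I\subseteq\{1,\dots,n\}$ with $|I|=k$ there exist a query point $q_I\in\{0,1\}^d$, a number $d_I$, and a set $I'\supseteq I$ with $|I'|\le 1.5|I|$, such that the Hamming distances satisfy $\|p_i-q_I\|_1\le d_I$ for all $i\in I$ and $\|p_i-q_I\|_1\ge d_I\left(1+\frac{1}{4(k-1)}\right)$ for all $i\notin I'$. Consequently, for $c<1+\frac{1}{4(k-1)}$, every valid answer to the $(c,k)$-NN query $q_I$ on these points is contained in $\{p_i:i\in I'\}$, and hence contains at least $k/2$ points with index in $I$.
   Context: $\|x-y\|_1$ for $x,y\in\{0,1\}^d$ is the Hamming distance. $(c,k)$-NN: a valid answer to query $q$ is a set of $k$ points each at distance at most $c$ times the distance from $q$ to its $k$-th nearest neighbor. -}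

module Defs where

open import Data.Bool using (Bool; true; false; if_then_else_; _xor_)
open import Data.Nat using (ℕ; zero; suc; _+_; _*_; _∸_; _≤_)
open import Data.Nat.Properties using (≤-decTotalOrder)
open import Data.Fin using (Fin)
open import Data.Fin.Subset using (Subset; _∈_; ∣_∣)
open import Data.Vec using (Vec; []; _∷_)
open import Data.List using (List; []; _∷_; map; allFin)
open import Data.List.Sort ≤-decTotalOrder using (sort)
open import Data.Product using (_×_)
open import Relation.Binary.PropositionalEquality using (_≡_)

hamming : ∀ {d} → Vec Bool d → Vec Bool d → ℕ
hamming [] [] = 0
hamming (x ∷ xs) (y ∷ ys) = (if x xor y then 1 else 0) + hamming xs ys

-- i-th element (0-based) of a list, default 0 when out of range
nth : List ℕ → ℕ → ℕ
nth [] _ = 0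
nth (x ∷ xs) zero = x
nth (x ∷ xs) (suc i) = nth xs i

dists : ∀ {n d} → (Fin n → Vec Bool d) → Vec Bool d → List ℕ
dists {n} p q = map (λ i → hamming (p i) q) (allFin n)

kthNNDist : ∀ {n d} → ℕ → (Fin n → Vec Bool d) → Vec Bool d → ℕ
kthNNDist k p q = nth (sort (dists p q)) (k ∸ 1)

-- S (a set of k point indices) is a valid answer to the (c,k)-NN query q,
-- where c = a / b (b > 0): every point of S is within distance c · r_k of q
ValidNN : ∀ {n d} → (a b k : ℕ) → (Fin n → Vec Bool d) → Vec Bool d → Subset n → Set
ValidNN a b k p q S =
  (∣ S ∣ ≡ k) × (∀ i → i ∈ S → b * hamming (p i) q ≤ a * kthNNDist k p q)

module Submission where

open import Defs
open import Data.Bool using (Bool)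
open import Data.Nat using (ℕ; _+_; _*_; _∸_; _^_; _≤_; _<_)
open import Data.Fin using (Fin)
open import Data.Fin.Subset using (Subset; _∈_; _∉_; _⊆_; _∩_; ∣_∣)
open import Data.Vec using (Vec)
open import Data.Product using (Σ; _×_)
open import Relation.Binary.PropositionalEquality using (_≡_)

open import Data.Nat using (z≤n; s≤s; _≤?_)
open import Data.Nat.Properties using (module ≤-Reasoning; ≤-trans; ≤-reflexive; ≰⇒>; *-identityˡ; ^-monoˡ-≤; *-distribˡ-∸; ∸-monoˡ-≤; m+n∸n≡m)
open import Data.Fin.Subset using (∁; _∪_)
open import Data.Fin.Subset.Properties using (∣∁p∣≡n∸∣p∣; p∪∁p≡⊤; ∈⊤)
open import Data.Vec using ([])
open import Data.Product using (_,_)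
open import Relation.Nullary using (yes; no; contradiction)
open import Relation.Binary.PropositionalEquality using (subst; sym; trans; cong)

-- If 2n ≤ 3k a code in dimension 0 already works: I′ = all indices, which exceeds I by
-- n - k ≤ k/2 points.  Otherwise the points are block words: a row of L = 8t letters from an
-- alphabet of 4k letters, with 2^t ≈ 16n/k, written letter by letter in one-hot form.  The
-- query of a k-set I lists, in every block, the letters used by the rows in I.  The distance
-- from a row to this query is  radius + 2·(number of blocks the row misses),  so the rows of
-- I are at distance exactly `radius`, while rows missing ≥ t blocks are far enough that no
-- valid (c,k)-NN answer can use them.  A counting form of the union bound shows that for some
-- choice of rows every k-set I has at most k/2 further rows missing fewer than t blocks; with
-- these added, I′ has at most 1.5k elements.

module FiniteSums where

  open import Data.Nat using (ℕ; zero; suc; _+_; _*_; _^_; _≤_; _<_; z≤n; s≤s)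
  open import Data.Nat.Properties
  open import Data.List using (List; []; _∷_; _++_; map; length; cartesianProductWith; allFin)
  open import Data.List.Properties using (map-tabulate)
  open import Data.Fin using (Fin; zero; suc)
  open import Data.List.Membership.Propositional using () renaming (_∈_ to _∈ₗ_)
  open import Data.List.Membership.Propositional.Properties using (∈-cartesianProductWith⁺)
  open import Data.List.Relation.Unary.Any using (here; there)
  open import Data.Vec using (Vec; []; _∷_)
  open import Data.Product using (Σ; _,_)
  open import Relation.Binary.PropositionalEquality
  open import Algebra.Properties.CommutativeSemigroup +-commutativeSemigroup using (interchange)

  ∑ : {A : Set} → List A → (A → ℕ) → ℕ
  ∑ []       f = 0
  ∑ (x ∷ xs) f = f x + ∑ xs f

  syntax ∑ xs (λ x → e) = ∑[ x ← xs ] e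

  module _ {A : Set} where

    ∑-++ : (xs ys : List A) (f : A → ℕ) → ∑ (xs ++ ys) f ≡ ∑ xs f + ∑ ys f
    ∑-++ []       ys f = refl
    ∑-++ (x ∷ xs) ys f rewrite ∑-++ xs ys f = sym (+-assoc (f x) (∑ xs f) (∑ ys f))

    ∑-map : {B : Set} (g : A → B) (xs : List A) (f : B → ℕ) →
            ∑ (map g xs) f ≡ ∑[ x ← xs ] f (g x)
    ∑-map g []       f = refl
    ∑-map g (x ∷ xs) f = cong (f (g x) +_) (∑-map g xs f)

    ∑-cong : (xs : List A) {f g : A → ℕ} → (∀ x → f x ≡ g x) → ∑ xs f ≡ ∑ xs g
    ∑-cong []       f≡g = refl
    ∑-cong (x ∷ xs) f≡g = cong₂ _+_ (f≡g x) (∑-cong xs f≡g)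

    ∑-mono : (xs : List A) {f g : A → ℕ} → (∀ x → f x ≤ g x) → ∑ xs f ≤ ∑ xs g
    ∑-mono []       f≤g = z≤n
    ∑-mono (x ∷ xs) f≤g = +-mono-≤ (f≤g x) (∑-mono xs f≤g)

    ∑-zero : (xs : List A) → ∑[ x ← xs ] 0 ≡ 0
    ∑-zero []       = refl
    ∑-zero (x ∷ xs) = ∑-zero xs

    ∑-+ : (xs : List A) (f g : A → ℕ) → ∑[ x ← xs ] (f x + g x) ≡ ∑ xs f + ∑ xs g
    ∑-+ []       f g = refl
    ∑-+ (x ∷ xs) f g = trans (cong (f x + g x +_) (∑-+ xs f g))
      (interchange (f x) (g x) (∑ xs f) (∑ xs g))

    ∑-*ˡ : (c : ℕ) (xs : List A) (f : A → ℕ) → c * ∑ xs f ≡ ∑[ x ← xs ] (c * f x)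
    ∑-*ˡ c []       f = *-zeroʳ c
    ∑-*ˡ c (x ∷ xs) f = trans (*-distribˡ-+ c (f x) (∑ xs f)) (cong (c * f x +_) (∑-*ˡ c xs f))

    ∑-*ʳ : (c : ℕ) (xs : List A) (f : A → ℕ) → ∑ xs f * c ≡ ∑[ x ← xs ] (f x * c)
    ∑-*ʳ c xs f = trans (*-comm (∑ xs f) c)
      (trans (∑-*ˡ c xs f) (∑-cong xs (λ x → *-comm c (f x))))

    ∑-const : (xs : List A) (c : ℕ) → ∑[ x ← xs ] c ≡ length xs * c
    ∑-const []       c = refl
    ∑-const (x ∷ xs) c = cong (c +_) (∑-const xs c)

    ∑-one : (xs : List A) → ∑[ x ← xs ] 1 ≡ length xs
    ∑-one xs = trans (∑-const xs 1) (*-identityʳ (length xs))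

    ∈⇒≤∑ : (xs : List A) (f : A → ℕ) {x : A} → x ∈ₗ xs → f x ≤ ∑ xs f
    ∈⇒≤∑ (y ∷ xs) f (here refl) = m≤m+n (f y) (∑ xs f)
    ∈⇒≤∑ (y ∷ xs) f (there x∈) = ≤-trans (∈⇒≤∑ xs f x∈) (m≤n+m (∑ xs f) (f y))

    ∑<length⇒zero : (xs : List A) (f : A → ℕ) → ∑ xs f < length xs → Σ A λ x → f x ≡ 0
    ∑<length⇒zero (x ∷ xs) f lt with f x in fx≡
    ... | zero  = x , fx≡
    ... | suc m = ∑<length⇒zero xs f (≤-pred (≤-trans (s≤s (s≤s (m≤n+m (∑ xs f) m))) lt))

  ∑-allFin-suc : ∀ {n} (f : Fin (suc n) → ℕ) → ∑ (allFin (suc n)) f ≡ f zero + ∑[ x ← allFin n ] f (suc x)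
  ∑-allFin-suc {n} f = cong (f zero +_)
    (trans (cong (λ xs → ∑ xs f) (sym (map-tabulate (λ x → x) suc))) (∑-map suc (allFin n) f))

  ∑-swap : {A B : Set} (xs : List A) (ys : List B) (f : A → B → ℕ) →
           ∑[ x ← xs ] ∑ ys (f x) ≡ ∑[ y ← ys ] ∑[ x ← xs ] f x y
  ∑-swap []       ys f = sym (∑-zero ys)
  ∑-swap (x ∷ xs) ys f = trans (cong (∑ ys (f x) +_) (∑-swap xs ys f))
    (sym (∑-+ ys (f x) (λ y → ∑[ x′ ← xs ] f x′ y)))

  vectors : {A : Set} → List A → (n : ℕ) → List (Vec A n)
  vectors xs zero    = [] ∷ []
  vectors xs (suc n) = cartesianProductWith _∷_ xs (vectors xs n)

  module _ {A : Set} where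

    ∑-vectors : (xs : List A) (n : ℕ) (f : Vec A (suc n) → ℕ) →
                ∑ (vectors xs (suc n)) f ≡ ∑[ x ← xs ] ∑[ v ← vectors xs n ] f (x ∷ v)
    ∑-vectors xs n f = go xs
      where
      go : (ys : List A) → ∑ (cartesianProductWith _∷_ ys (vectors xs n)) f
                         ≡ ∑[ x ← ys ] ∑[ v ← vectors xs n ] f (x ∷ v)
      go []       = refl
      go (y ∷ ys) = trans (∑-++ (map (y ∷_) (vectors xs n)) _ f)
        (cong₂ _+_ (∑-map (y ∷_) (vectors xs n) f) (go ys))

    ∈-vectors : (xs : List A) → (∀ x → x ∈ₗ xs) → ∀ {n} (v : Vec A n) → v ∈ₗ vectors xs n
    ∈-vectors xs all []      = here refl
    ∈-vectors xs all (x ∷ v) = ∈-cartesianProductWith⁺ _∷_ (all x) (∈-vectors xs all v)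

    length-vectors : (xs : List A) (n : ℕ) → length (vectors xs n) ≡ length xs ^ n
    length-vectors xs zero    = refl
    length-vectors xs (suc n) = begin
      length (vectors xs (suc n))              ≡⟨ sym (∑-one (vectors xs (suc n))) ⟩
      ∑[ v ← vectors xs (suc n) ] 1            ≡⟨ ∑-vectors xs n (λ _ → 1) ⟩
      ∑[ x ← xs ] ∑[ v ← vectors xs n ] 1      ≡⟨ ∑-cong xs (λ _ → ∑-one (vectors xs n)) ⟩
      ∑[ x ← xs ] length (vectors xs n)        ≡⟨ ∑-const xs _ ⟩
      length xs * length (vectors xs n)        ≡⟨ cong (length xs *_) (length-vectors xs n) ⟩
      length xs ^ suc n                        ∎
      where open ≡-Reasoning

module SubsetCounting where

  open import Data.Nat using (ℕ; zero; suc; _+_; _*_; _≤_; z≤n; s≤s; _≡ᵇ_)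
  open import Data.Nat.Properties
  open import Data.Nat.Combinatorics using (_C_; nCk+nC[k+1]≡[n+1]C[k+1])
  open import Data.Bool using (Bool; true; false; _∧_; T)
  open import Data.Unit using (tt)
  open import Data.Fin.Subset using (Subset; _⊆_; _∩_; _∪_; ∣_∣; Nonempty)
  open import Data.Fin.Subset.Properties using (∣p∣≤∣x∷p∣; p⊆q⇒∣p∣≤∣q∣; x∈p∪q⁻; x∈p∪q⁺; x∈p∩q⁺; nonempty?; Empty-unique; ∣⊥∣≡0)
  open import Relation.Nullary using (yes; no)
  open import Data.Vec using ([]; _∷_; here; there)
  open import Data.List using (List; []; _∷_)
  open import Data.List.Membership.Propositional using () renaming (_∈_ to _∈ₗ_)
  open import Data.List.Relation.Unary.Any using (here; there)
  open import Data.Product using (Σ; _×_; _,_)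
  open import Data.Sum using (inj₁; inj₂)
  open import Relation.Binary.PropositionalEquality
  open FiniteSums

  𝟙 : Bool → ℕ
  𝟙 true  = 1
  𝟙 false = 0

  𝟙-∧ : ∀ a b → 𝟙 (a ∧ b) ≡ 𝟙 a * 𝟙 b
  𝟙-∧ true  b = sym (+-identityʳ (𝟙 b))
  𝟙-∧ false b = refl

  ≡ᵇ-refl : ∀ k → (k ≡ᵇ k) ≡ true
  ≡ᵇ-refl zero    = refl
  ≡ᵇ-refl (suc k) = ≡ᵇ-refl k

  ≡ᵇ-true⇒≡ : ∀ m k → (m ≡ᵇ k) ≡ true → m ≡ k
  ≡ᵇ-true⇒≡ m k e = ≡ᵇ⇒≡ m k (subst T (sym e) tt)

  -- subsets of an n-set are boolean vectors, enumerated by vectors Bools n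
  Bools : List Bool
  Bools = false ∷ true ∷ []

  ∈-Bools : ∀ b → b ∈ₗ Bools
  ∈-Bools false = here refl
  ∈-Bools true  = there (here refl)

  -- an n-set has (n choose k) subsets of size k; splitting on the first element gives Pascal's rule
  ∑-subsets-of-size : ∀ n k → ∑[ I ← vectors Bools n ] 𝟙 (∣ I ∣ ≡ᵇ k) ≡ n C k
  ∑-subsets-of-size zero    zero    = refl
  ∑-subsets-of-size zero    (suc k) = refl
  ∑-subsets-of-size (suc n) k = trans (∑-vectors Bools n _)
    (trans (cong (count k +_) (+-identityʳ (∑[ I ← vectors Bools n ] 𝟙 (suc ∣ I ∣ ≡ᵇ k)))) (pascal k))
    where
    count : ℕ → ℕ
    count k = ∑[ I ← vectors Bools n ] 𝟙 (∣ I ∣ ≡ᵇ k)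
    pascal : ∀ k → count k + ∑[ I ← vectors Bools n ] 𝟙 (suc ∣ I ∣ ≡ᵇ k) ≡ suc n C k
    pascal zero    = trans (cong (count 0 +_) (∑-zero (vectors Bools n)))
                           (trans (+-identityʳ (count 0)) (∑-subsets-of-size n 0))
    pascal (suc k) = trans (+-comm (count (suc k)) (count k))
      (trans (cong₂ _+_ (∑-subsets-of-size n k) (∑-subsets-of-size n (suc k)))
             (nCk+nC[k+1]≡[n+1]C[k+1] n k))

  ∣p∪q∣≤∣p∣+∣q∣ : ∀ {n} (p q : Subset n) → ∣ p ∪ q ∣ ≤ ∣ p ∣ + ∣ q ∣
  ∣p∪q∣≤∣p∣+∣q∣ []          []         = z≤n
  ∣p∪q∣≤∣p∣+∣q∣ (true ∷ p)  (b ∷ q)    =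
    s≤s (≤-trans (∣p∪q∣≤∣p∣+∣q∣ p q) (+-monoʳ-≤ ∣ p ∣ (∣p∣≤∣x∷p∣ b q)))
  ∣p∪q∣≤∣p∣+∣q∣ (false ∷ p) (true ∷ q) =
    ≤-trans (s≤s (∣p∪q∣≤∣p∣+∣q∣ p q)) (≤-reflexive (sym (+-suc ∣ p ∣ ∣ q ∣)))
  ∣p∪q∣≤∣p∣+∣q∣ (false ∷ p) (false ∷ q) = ∣p∪q∣≤∣p∣+∣q∣ p q

  covered-size : ∀ {n} (S I X : Subset n) → S ⊆ I ∪ X → ∣ S ∣ ≤ ∣ S ∩ I ∣ + ∣ X ∣
  covered-size S I X S⊆I∪X = ≤-trans (p⊆q⇒∣p∣≤∣q∣ S⊆[S∩I]∪X) (∣p∪q∣≤∣p∣+∣q∣ (S ∩ I) X)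
    where
    S⊆[S∩I]∪X : S ⊆ (S ∩ I) ∪ X
    S⊆[S∩I]∪X {x} x∈S with x∈p∪q⁻ I X (S⊆I∪X x∈S)
    ... | inj₁ x∈I = x∈p∪q⁺ (inj₁ (x∈p∩q⁺ (x∈S , x∈I)))
    ... | inj₂ x∈X = x∈p∪q⁺ (inj₂ x∈X)

  subset-of-size : ∀ {n} (X : Subset n) (m : ℕ) → m ≤ ∣ X ∣ → Σ (Subset n) λ J → J ⊆ X × ∣ J ∣ ≡ m
  subset-of-size []          zero    _       = [] , (λ ()) , refl
  subset-of-size (b ∷ X)     zero    _       with subset-of-size X zero z≤n
  ... | J , J⊆X , ∣J∣≡0 = false ∷ J , (λ { (there x∈J) → there (J⊆X x∈J) }) , ∣J∣≡0
  subset-of-size (true ∷ X)  (suc m) (s≤s m≤) with subset-of-size X m m≤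
  ... | J , J⊆X , ∣J∣≡m = true ∷ J , (λ { here → here ; (there x∈J) → there (J⊆X x∈J) }) , cong suc ∣J∣≡m
  subset-of-size (false ∷ X) (suc m) m≤      with subset-of-size X (suc m) m≤
  ... | J , J⊆X , ∣J∣≡m = false ∷ J , (λ { (there x∈J) → there (J⊆X x∈J) }) , ∣J∣≡m

  nonempty : ∀ {n} (I : Subset n) → 1 ≤ ∣ I ∣ → Nonempty I
  nonempty {n} I 1≤∣I∣ with nonempty? I
  ... | yes i∈I = i∈I
  ... | no  empty with () ← ≤-trans 1≤∣I∣ (≤-reflexive (trans (cong ∣_∣ (Empty-unique empty)) (∣⊥∣≡0 n)))

module BinomialEstimates where

  open import Data.Nat using (zero; suc; _+_; _*_; _^_; _≤_; _!; z≤n; s≤s; NonZero)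
  open import Data.Nat.Properties
  open import Data.Nat.DivMod using (_/_; _%_; m≡m%n+[m/n]*n; m%n<n)
  open import Data.Nat.Combinatorics using (_C_; nCk+nC[k+1]≡[n+1]C[k+1])
  open import Data.Nat.Tactic.RingSolver using (solve-∀)
  open import Data.Product using (_,_)
  open import Relation.Binary.PropositionalEquality

  *-^-distrib : ∀ a b n → (a * b) ^ n ≡ a ^ n * b ^ n
  *-^-distrib a b zero    = refl
  *-^-distrib a b (suc n) = trans (cong (a * b *_) (*-^-distrib a b n)) (swap a b (a ^ n) (b ^ n))
    where
    swap : ∀ a b x y → a * b * (x * y) ≡ a * x * (b * y)
    swap = solve-∀

  bernoulli : ∀ n k → n ^ suc k + suc k * n ^ k ≤ suc n ^ suc k
  bernoulli n zero    = ≤-reflexive (base n)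
    where
    base : ∀ n → n * 1 + 1 * 1 ≡ (1 + n) * 1
    base = solve-∀
  bernoulli n (suc k) = begin
    n ^ suc (suc k) + suc (suc k) * n ^ suc k
      ≡⟨ regroup n k (n ^ k) ⟩
    n ^ suc (suc k) + suc k * n ^ suc k + n ^ suc k
      ≤⟨ +-monoʳ-≤ _ (m≤m+n (n ^ suc k) (suc k * n ^ k)) ⟩
    n ^ suc (suc k) + suc k * n ^ suc k + (n ^ suc k + suc k * n ^ k)
      ≡⟨ factor n k (n ^ k) ⟩
    suc n * (n ^ suc k + suc k * n ^ k)
      ≤⟨ *-monoʳ-≤ (suc n) (bernoulli n k) ⟩
    suc n ^ suc (suc k) ∎
    where
    open ≤-Reasoning
    regroup : ∀ n k x → n * (n * x) + (2 + k) * (n * x) ≡ n * (n * x) + (1 + k) * (n * x) + n * x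
    regroup = solve-∀
    factor : ∀ n k x → n * (n * x) + (1 + k) * (n * x) + (n * x + (1 + k) * x)
                     ≡ (1 + n) * (n * x + (1 + k) * x)
    factor = solve-∀

  nCk*k!≤n^k : ∀ n k → (n C k) * k ! ≤ n ^ k
  nCk*k!≤n^k n       zero    = ≤-refl
  nCk*k!≤n^k zero    (suc k) = z≤n
  nCk*k!≤n^k (suc n) (suc k) = begin
    (suc n C suc k) * (suc k * k !)
      ≡⟨ cong (_* (suc k * k !)) (sym (nCk+nC[k+1]≡[n+1]C[k+1] n k)) ⟩
    (n C k + n C suc k) * (suc k * k !)
      ≡⟨ expand (n C k) (n C suc k) k (k !) ⟩
    suc k * ((n C k) * k !) + (n C suc k) * (suc k * k !)
      ≤⟨ +-mono-≤ (*-monoʳ-≤ (suc k) (nCk*k!≤n^k n k)) (nCk*k!≤n^k n (suc k)) ⟩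
    suc k * n ^ k + n ^ suc k
      ≡⟨ +-comm (suc k * n ^ k) (n ^ suc k) ⟩
    n ^ suc k + suc k * n ^ k
      ≤⟨ bernoulli n k ⟩
    suc n ^ suc k ∎
    where
    open ≤-Reasoning
    expand : ∀ a b k f → (a + b) * ((1 + k) * f) ≡ (1 + k) * (a * f) + b * ((1 + k) * f)
    expand = solve-∀

  power-shift : ∀ k m j → m + j ≡ k → suc k ^ m * j ≤ k ^ suc m
  power-shift k zero    j refl = ≤-reflexive (trans (+-identityʳ j) (sym (*-identityʳ j)))
  power-shift k (suc m) j m+j≡k = begin
    suc k ^ suc m * j     ≡⟨ assoc₁ k (suc k ^ m) j ⟩
    suc k ^ m * (suc k * j) ≤⟨ *-monoʳ-≤ (suc k ^ m) step ⟩
    suc k ^ m * (k * suc j) ≡⟨ assoc₂ (suc k ^ m) k (suc j) ⟩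
    k * (suc k ^ m * suc j) ≤⟨ *-monoʳ-≤ k (power-shift k m (suc j) (trans (+-suc m j) m+j≡k)) ⟩
    k * k ^ suc m ∎
    where
    open ≤-Reasoning
    assoc₁ : ∀ k x j → (1 + k) * x * j ≡ x * ((1 + k) * j)
    assoc₁ = solve-∀
    assoc₂ : ∀ x k j → x * (k * j) ≡ k * (x * j)
    assoc₂ = solve-∀
    -- (k+1)·j ≤ k·(j+1) because j ≤ k
    step : suc k * j ≤ k * suc j
    step = begin
      suc k * j  ≡⟨ *-comm (suc k) j ⟩
      j * suc k  ≡⟨ *-suc j k ⟩
      j + j * k  ≤⟨ +-mono-≤ (subst (j ≤_) m+j≡k (m≤n+m j (suc m))) (≤-reflexive (*-comm j k)) ⟩
      k + k * j  ≡⟨ sym (*-suc k j) ⟩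
      k * suc j  ∎

  half-power : ∀ k a → 2 * a ≤ k → .{{NonZero k}} → suc k ^ a ≤ 2 * k ^ a
  half-power k a 2a≤k with m≤n⇒∃[o]m+o≡n (≤-trans (m≤m+n a (a + 0)) 2a≤k)
  ... | j , a+j≡k = *-cancelʳ-≤ (suc k ^ a) (2 * k ^ a) k (begin
    suc k ^ a * k        ≤⟨ *-monoʳ-≤ (suc k ^ a) k≤2j ⟩
    suc k ^ a * (2 * j)  ≡⟨ shuffle (suc k ^ a) j ⟩
    2 * (suc k ^ a * j)  ≤⟨ *-monoʳ-≤ 2 (power-shift k a j a+j≡k) ⟩
    2 * (k * k ^ a)      ≡⟨ shuffle′ k (k ^ a) ⟩
    2 * k ^ a * k        ∎)
    where
    open ≤-Reasoning
    shuffle : ∀ x j → x * (2 * j) ≡ 2 * (x * j)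
    shuffle = solve-∀
    shuffle′ : ∀ k x → 2 * (k * x) ≡ 2 * x * k
    shuffle′ = solve-∀
    k≤2j : k ≤ 2 * j
    k≤2j = begin
      k           ≡⟨ sym a+j≡k ⟩
      a + j       ≤⟨ +-monoˡ-≤ j (+-cancelˡ-≤ a a j (subst (a + a ≤_) (sym a+j≡k)
                       (subst (_≤ k) (cong (a +_) (+-identityʳ a)) 2a≤k))) ⟩
      j + j       ≡⟨ cong (j +_) (sym (+-identityʳ j)) ⟩
      2 * j       ∎

  -- (k+1)^k ≤ 8·k^k, a discrete form of (1 + 1/k)^k ≤ e
  succ-power : ∀ k → suc k ^ k ≤ 8 * k ^ k
  succ-power zero          = s≤s z≤n
  succ-power k@(suc _)     = begin
    suc k ^ k                                  ≡⟨ cong (suc k ^_) k≡e+a+a ⟩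
    suc k ^ (e + (a + a))                      ≡⟨ split (suc k) e a ⟩
    suc k ^ e * (suc k ^ a * suc k ^ a)        ≤⟨ *-mono-≤ parity (*-mono-≤ half half) ⟩
    2 * k ^ e * (2 * k ^ a * (2 * k ^ a))      ≡⟨ collect (k ^ e) (k ^ a) ⟩
    8 * (k ^ e * (k ^ a * k ^ a))              ≡⟨ cong (8 *_) (sym (split k e a)) ⟩
    8 * k ^ (e + (a + a))                      ≡⟨ cong (λ m → 8 * k ^ m) (sym k≡e+a+a) ⟩
    8 * k ^ k                                  ∎
    where
    open ≤-Reasoning
    a = k / 2
    e = k % 2
    k≡e+a+a : k ≡ e + (a + a)
    k≡e+a+a = trans (m≡m%n+[m/n]*n k 2) (cong (e +_) (trans (*-comm a 2) (cong (a +_) (+-identityʳ a))))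
    split : ∀ x e a → x ^ (e + (a + a)) ≡ x ^ e * (x ^ a * x ^ a)
    split x e a = trans (^-distribˡ-+-* x e (a + a)) (cong (x ^ e *_) (^-distribˡ-+-* x a a))
    collect : ∀ x y → 2 * x * (2 * y * (2 * y)) ≡ 8 * (x * (y * y))
    collect = solve-∀
    -- each half of the exponent costs a factor 2, the remaining parity bit another one
    half : suc k ^ a ≤ 2 * k ^ a
    half = half-power k a (subst (_≤ k) (cong (_+_ a) (sym (+-identityʳ a)))
             (subst (a + a ≤_) (sym k≡e+a+a) (m≤n+m (a + a) e)))
    parity : suc k ^ e ≤ 2 * k ^ e
    parity with e | m%n<n k 2
    ... | zero        | _              = s≤s z≤n
    ... | suc zero    | _              = subst₂ _≤_ (sym (*-identityʳ (suc k))) (cong (2 *_) (sym (*-identityʳ k)))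
                                          (+-mono-≤ (s≤s z≤n) (≤-reflexive (sym (+-identityʳ k))))
    ... | suc (suc _) | s≤s (s≤s ())

  k^k≤8^k*k! : ∀ k → k ^ k ≤ 8 ^ k * k !
  k^k≤8^k*k! zero    = s≤s z≤n
  k^k≤8^k*k! (suc k) = begin
    suc k * suc k ^ k            ≤⟨ *-monoʳ-≤ (suc k) (succ-power k) ⟩
    suc k * (8 * k ^ k)          ≤⟨ *-monoʳ-≤ (suc k) (*-monoʳ-≤ 8 (k^k≤8^k*k! k)) ⟩
    suc k * (8 * (8 ^ k * k !))  ≡⟨ regroup (suc k) (8 ^ k) (k !) ⟩
    8 * 8 ^ k * (suc k * k !)    ∎
    where
    open ≤-Reasoning
    regroup : ∀ k x f → k * (8 * (x * f)) ≡ 8 * x * (k * f)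
    regroup = solve-∀

  binomial-bound : ∀ n m t → 8 * n ≤ 2 ^ t * m → n C m ≤ 2 ^ (t * m)
  binomial-bound n zero      t _ rewrite *-zeroʳ t = ≤-refl
  binomial-bound n m@(suc _) t 8n≤2^tm = *-cancelʳ-≤ (n C m) (2 ^ (t * m)) (8 ^ m * m ^ m) {{nonzero}} (begin
    (n C m) * (8 ^ m * m ^ m)       ≡⟨ rearrange (n C m) (8 ^ m) (m ^ m) ⟩
    8 ^ m * ((n C m) * m ^ m)       ≤⟨ *-monoʳ-≤ (8 ^ m) (*-monoʳ-≤ (n C m) (k^k≤8^k*k! m)) ⟩
    8 ^ m * ((n C m) * (8 ^ m * m !)) ≡⟨ cong (8 ^ m *_) (rearrange (n C m) (8 ^ m) (m !)) ⟩
    8 ^ m * (8 ^ m * ((n C m) * m !)) ≤⟨ *-monoʳ-≤ (8 ^ m) (*-monoʳ-≤ (8 ^ m) (nCk*k!≤n^k n m)) ⟩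
    8 ^ m * (8 ^ m * n ^ m)       ≡⟨ cong (8 ^ m *_) (sym (*-^-distrib 8 n m)) ⟩
    8 ^ m * (8 * n) ^ m           ≤⟨ *-monoʳ-≤ (8 ^ m) (^-monoˡ-≤ m 8n≤2^tm) ⟩
    8 ^ m * (2 ^ t * m) ^ m       ≡⟨ cong (8 ^ m *_) (trans (*-^-distrib (2 ^ t) m m)
                                                     (cong (_* m ^ m) (^-*-assoc 2 t m))) ⟩
    8 ^ m * (2 ^ (t * m) * m ^ m) ≡⟨ rearrange (8 ^ m) (2 ^ (t * m)) (m ^ m) ⟩
    2 ^ (t * m) * (8 ^ m * m ^ m) ∎)
    where
    open ≤-Reasoning
    rearrange : ∀ x y z → x * (y * z) ≡ y * (x * z)
    rearrange = solve-∀
    nonzero : NonZero (8 ^ m * m ^ m)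
    nonzero = m*n≢0 (8 ^ m) (m ^ m) {{m^n≢0 8 m}} {{m^n≢0 m m}}

module UnionBound where

  open import Data.Nat using (ℕ; zero; suc; _+_; _*_; _^_; _≤_; _<_; z≤n; _≡ᵇ_; NonZero)
  open import Data.Nat.Properties
  open import Data.Nat.Combinatorics using (_C_)
  open import Data.Nat.Tactic.RingSolver using (solve-∀)
  open import Data.Bool using (true; false; _∧_)
  open import Data.Fin using (zero; suc)
  open import Data.Fin.Subset using (Subset; _∈_; _∉_; ∣_∣)
  open import Data.Fin.Subset.Properties using (drop-not-there)
  open import Data.Vec using (Vec; []; _∷_; lookup; here; there)
  open import Data.List using (List; []; _∷_; length)
  open import Data.Product using (Σ; _×_; _,_)
  open import Relation.Nullary using (contradiction)
  open import Relation.Binary.PropositionalEquality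
  open import Algebra.Properties.CommutativeSemigroup *-commutativeSemigroup using (x∙yz≈y∙xz)
  open FiniteSums
  open SubsetCounting using (𝟙; 𝟙-∧; ≡ᵇ-refl; ≡ᵇ-true⇒≡; Bools; ∈-Bools; ∑-subsets-of-size)

  build : ∀ {A S : Set} {n} → (A → S → S) → S → Subset n → Vec A n → S
  build ins Q []          []      = Q
  build ins Q (true ∷ I)  (y ∷ h) = build ins (ins y Q) I h
  build ins Q (false ∷ I) (y ∷ h) = build ins Q I h

  -- The union bound of the probabilistic method, phrased as counting.  A configuration h assigns
  -- one of the R candidate rows to each of n indices; a k-set I determines the state
  -- build ins Q₀ I h, and the pair (I, J) is bad when every row of h in J is close to that state.
  -- Closeness is a weight `close Q y`, so that counting and averaging become sums.
  module Counting {A S : Set} (rows : List A) (ins : A → S → S) (close : S → A → ℕ) where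

    R : ℕ
    R = length rows

    private
      drop-hyp : ∀ {n b} {I : Subset n} {j} {w} → suc j ∉ (b ∷ I) × w ≡ 1 → j ∉ I × w ≡ 1
      drop-hyp (j∉ , w≡1) = drop-not-there j∉ , w≡1

    event : ∀ {n} → Subset n → Subset n → Vec A n → S → ℕ
    event []          []          []      Q = 1
    event (true ∷ I)  (true ∷ J)  (y ∷ h) Q = 0
    event (false ∷ I) (true ∷ J)  (y ∷ h) Q = close Q y * event I J h Q
    event (b ∷ I)     (false ∷ J) (y ∷ h) Q = event I J h Q

    event-one : ∀ {n} (I J : Subset n) (h : Vec A n) (Q : S) →
                  (∀ j → j ∈ J → j ∉ I × close Q (lookup h j) ≡ 1) → event I J h Q ≡ 1
    event-one []          []          []      Q hyp = refl
    event-one (true ∷ I)  (true ∷ J)  (y ∷ h) Q hyp = contradiction here (Σ.proj₁ (hyp zero here))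
    event-one (false ∷ I) (true ∷ J)  (y ∷ h) Q hyp =
      cong₂ _*_ (Σ.proj₂ (hyp zero here)) (event-one I J h Q (λ j j∈J → drop-hyp (hyp (suc j) (there j∈J))))
    event-one (true ∷ I)  (false ∷ J) (y ∷ h) Q hyp =
      event-one I J h Q (λ j j∈J → drop-hyp (hyp (suc j) (there j∈J)))
    event-one (false ∷ I) (false ∷ J) (y ∷ h) Q hyp =
      event-one I J h Q (λ j j∈J → drop-hyp (hyp (suc j) (there j∈J)))

    weight : ∀ {n} → S → Subset n → Subset n → ℕ
    weight {n} Q I J = ∑[ h ← vectors rows n ] event I J h (build ins Q I h)

    -- If every reachable state gives total weight at most N to the candidates, the event for
    -- (I, J) has weight at most N^|J| · R^(n - |J|): the state only depends on the rows in I,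
    -- and each row in J contributes a factor N instead of R.  (d is an arbitrary candidate,
    -- used to restrict the hypothesis to configurations of the remaining indices.)
    weight-bound : (d : A) (N : ℕ) → ∀ {n} (Q : S) (I J : Subset n) →
                   (∀ h → ∑ rows (close (build ins Q I h)) ≤ N) →
                   weight Q I J * R ^ ∣ J ∣ ≤ N ^ ∣ J ∣ * R ^ n
    weight-bound d N Q []          []          hN = ≤-refl
    weight-bound d N {suc n} Q (true ∷ I) (true ∷ J) hN = begin
      weight Q (true ∷ I) (true ∷ J) * R ^ suc ∣ J ∣
        ≡⟨ cong (_* R ^ suc ∣ J ∣) (trans (∑-vectors rows n _)
             (trans (∑-cong rows (λ _ → ∑-zero (vectors rows n))) (∑-zero rows))) ⟩
      0 ≤⟨ z≤n ⟩
      N ^ suc ∣ J ∣ * R ^ suc n ∎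
      where open ≤-Reasoning
    weight-bound d N {suc n} Q (false ∷ I) (false ∷ J) hN = begin
      weight Q (false ∷ I) (false ∷ J) * R ^ ∣ J ∣
        ≡⟨ cong (_* R ^ ∣ J ∣) (trans (∑-vectors rows n _) (∑-const rows (weight Q I J))) ⟩
      R * weight Q I J * R ^ ∣ J ∣
        ≡⟨ *-assoc R (weight Q I J) (R ^ ∣ J ∣) ⟩
      R * (weight Q I J * R ^ ∣ J ∣)
        ≤⟨ *-monoʳ-≤ R (weight-bound d N Q I J (λ h → hN (d ∷ h))) ⟩
      R * (N ^ ∣ J ∣ * R ^ n)
        ≡⟨ x∙yz≈y∙xz R (N ^ ∣ J ∣) (R ^ n) ⟩
      N ^ ∣ J ∣ * R ^ suc n ∎
      where open ≤-Reasoning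
    weight-bound d N {suc n} Q (true ∷ I) (false ∷ J) hN = begin
      weight Q (true ∷ I) (false ∷ J) * R ^ ∣ J ∣
        ≡⟨ cong (_* R ^ ∣ J ∣) (∑-vectors rows n _) ⟩
      ∑[ y ← rows ] weight (ins y Q) I J * R ^ ∣ J ∣
        ≡⟨ ∑-*ʳ (R ^ ∣ J ∣) rows (λ y → weight (ins y Q) I J) ⟩
      ∑[ y ← rows ] (weight (ins y Q) I J * R ^ ∣ J ∣)
        ≤⟨ ∑-mono rows (λ y → weight-bound d N (ins y Q) I J (λ h → hN (y ∷ h))) ⟩
      ∑[ y ← rows ] (N ^ ∣ J ∣ * R ^ n)
        ≡⟨ ∑-const rows (N ^ ∣ J ∣ * R ^ n) ⟩
      R * (N ^ ∣ J ∣ * R ^ n)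
        ≡⟨ x∙yz≈y∙xz R (N ^ ∣ J ∣) (R ^ n) ⟩
      N ^ ∣ J ∣ * R ^ suc n ∎
      where open ≤-Reasoning
    weight-bound d N {suc n} Q (false ∷ I) (true ∷ J) hN = begin
      weight Q (false ∷ I) (true ∷ J) * R ^ suc ∣ J ∣
        ≡⟨ cong (_* R ^ suc ∣ J ∣) (trans (∑-vectors rows n _) (∑-swap rows (vectors rows n) _)) ⟩
      ∑[ h ← vectors rows n ] ∑[ y ← rows ] (close (Qh h) y * event I J h (Qh h)) * R ^ suc ∣ J ∣
        ≡⟨ cong (_* R ^ suc ∣ J ∣) (∑-cong (vectors rows n)
             (λ h → sym (∑-*ʳ (event I J h (Qh h)) rows (close (Qh h))))) ⟩
      ∑[ h ← vectors rows n ] (∑ rows (close (Qh h)) * event I J h (Qh h)) * R ^ suc ∣ J ∣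
        ≤⟨ *-monoˡ-≤ (R ^ suc ∣ J ∣) (∑-mono (vectors rows n)
             (λ h → *-monoˡ-≤ (event I J h (Qh h)) (hN (d ∷ h)))) ⟩
      ∑[ h ← vectors rows n ] (N * event I J h (Qh h)) * R ^ suc ∣ J ∣
        ≡⟨ cong (_* R ^ suc ∣ J ∣) (sym (∑-*ˡ N (vectors rows n) _)) ⟩
      N * weight Q I J * (R * R ^ ∣ J ∣)
        ≡⟨ regroup N (weight Q I J) R (R ^ ∣ J ∣) ⟩
      N * R * (weight Q I J * R ^ ∣ J ∣)
        ≤⟨ *-monoʳ-≤ (N * R) (weight-bound d N Q I J (λ h → hN (d ∷ h))) ⟩
      N * R * (N ^ ∣ J ∣ * R ^ n)
        ≡⟨ regroup′ N R (N ^ ∣ J ∣) (R ^ n) ⟩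
      N ^ suc ∣ J ∣ * R ^ suc n ∎
      where
      open ≤-Reasoning
      Qh : Vec A n → S
      Qh h = build ins Q I h
      regroup : ∀ a b c d → a * b * (c * d) ≡ a * c * (b * d)
      regroup = solve-∀
      regroup′ : ∀ a b c d → a * b * (c * d) ≡ a * c * (b * d)
      regroup′ = solve-∀

    module _ {n : ℕ} (Q₀ : S) (k s : ℕ) where

      badness : Vec A n → ℕ
      badness h = ∑[ I ← vectors Bools n ] ∑[ J ← vectors Bools n ]
                    (𝟙 ((∣ I ∣ ≡ᵇ k) ∧ (∣ J ∣ ≡ᵇ s)) * event I J h (build ins Q₀ I h))

      pair-count : ∑[ I ← vectors Bools n ] ∑[ J ← vectors Bools n ] 𝟙 ((∣ I ∣ ≡ᵇ k) ∧ (∣ J ∣ ≡ᵇ s))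
                   ≡ (n C k) * (n C s)
      pair-count = begin
        ∑[ I ← vectors Bools n ] ∑[ J ← vectors Bools n ] 𝟙 ((∣ I ∣ ≡ᵇ k) ∧ (∣ J ∣ ≡ᵇ s))
          ≡⟨ ∑-cong (vectors Bools n) (λ I → trans (∑-cong (vectors Bools n) (λ J → 𝟙-∧ (∣ I ∣ ≡ᵇ k) _))
               (sym (∑-*ˡ (𝟙 (∣ I ∣ ≡ᵇ k)) (vectors Bools n) _))) ⟩
        ∑[ I ← vectors Bools n ] (𝟙 (∣ I ∣ ≡ᵇ k) * ∑[ J ← vectors Bools n ] 𝟙 (∣ J ∣ ≡ᵇ s))
          ≡⟨ sym (∑-*ʳ _ (vectors Bools n) _) ⟩
        ∑[ I ← vectors Bools n ] 𝟙 (∣ I ∣ ≡ᵇ k) * ∑[ J ← vectors Bools n ] 𝟙 (∣ J ∣ ≡ᵇ s)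
          ≡⟨ cong₂ _*_ (∑-subsets-of-size n k) (∑-subsets-of-size n s) ⟩
        (n C k) * (n C s) ∎
        where open ≡-Reasoning

      -- union bound: the expected number of bad pairs, times R^n
      badness-total : (d : A) (N : ℕ) →
        (∀ (I : Subset n) → ∣ I ∣ ≡ k → ∀ h → ∑ rows (close (build ins Q₀ I h)) ≤ N) →
        ∑[ h ← vectors rows n ] badness h * R ^ s ≤ (n C k) * (n C s) * (N ^ s * R ^ n)
      badness-total d N hN = begin
        ∑[ h ← vectors rows n ] badness h * R ^ s
          ≡⟨ cong (_* R ^ s) exchange ⟩
        ∑[ I ← vectors Bools n ] ∑[ J ← vectors Bools n ] (v I J * weight Q₀ I J) * R ^ s
          ≡⟨ trans (∑-*ʳ (R ^ s) (vectors Bools n) _)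
               (∑-cong (vectors Bools n) (λ I → ∑-*ʳ (R ^ s) (vectors Bools n) _)) ⟩
        ∑[ I ← vectors Bools n ] ∑[ J ← vectors Bools n ] (v I J * weight Q₀ I J * R ^ s)
          ≤⟨ ∑-mono (vectors Bools n) (λ I → ∑-mono (vectors Bools n) (per-pair I)) ⟩
        ∑[ I ← vectors Bools n ] ∑[ J ← vectors Bools n ] (v I J * (N ^ s * R ^ n))
          ≡⟨ sym (trans (∑-*ʳ (N ^ s * R ^ n) (vectors Bools n) _)
               (∑-cong (vectors Bools n) (λ I → ∑-*ʳ (N ^ s * R ^ n) (vectors Bools n) _))) ⟩
        (∑[ I ← vectors Bools n ] ∑[ J ← vectors Bools n ] v I J) * (N ^ s * R ^ n)
          ≡⟨ cong (_* (N ^ s * R ^ n)) pair-count ⟩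
        (n C k) * (n C s) * (N ^ s * R ^ n) ∎
        where
        open ≤-Reasoning
        v : Subset n → Subset n → ℕ
        v I J = 𝟙 ((∣ I ∣ ≡ᵇ k) ∧ (∣ J ∣ ≡ᵇ s))
        exchange : ∑[ h ← vectors rows n ] badness h
                 ≡ ∑[ I ← vectors Bools n ] ∑[ J ← vectors Bools n ] (v I J * weight Q₀ I J)
        exchange = trans (∑-swap (vectors rows n) (vectors Bools n) _)
          (∑-cong (vectors Bools n) (λ I → trans (∑-swap (vectors rows n) (vectors Bools n) _)
            (∑-cong (vectors Bools n) (λ J → sym (∑-*ˡ (v I J) (vectors rows n) _)))))
        per-pair : ∀ I J → v I J * weight Q₀ I J * R ^ s ≤ v I J * (N ^ s * R ^ n)
        per-pair I J with ∣ I ∣ ≡ᵇ k in eI | ∣ J ∣ ≡ᵇ s in eJ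
        ... | false | _     = z≤n
        ... | true  | false = z≤n
        ... | true  | true  = begin
          (weight Q₀ I J + 0) * R ^ s   ≡⟨ cong (_* R ^ s) (+-identityʳ (weight Q₀ I J)) ⟩
          weight Q₀ I J * R ^ s         ≡⟨ cong (λ m → weight Q₀ I J * R ^ m) (sym ∣J∣≡s) ⟩
          weight Q₀ I J * R ^ ∣ J ∣     ≤⟨ weight-bound d N Q₀ I J (hN I (≡ᵇ-true⇒≡ ∣ I ∣ k eI)) ⟩
          N ^ ∣ J ∣ * R ^ n             ≡⟨ cong (λ m → N ^ m * R ^ n) ∣J∣≡s ⟩
          N ^ s * R ^ n                 ≡⟨ sym (+-identityʳ _) ⟩
          N ^ s * R ^ n + 0             ∎
          where ∣J∣≡s = ≡ᵇ-true⇒≡ ∣ J ∣ s eJ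

      good-configuration : (d : A) (N : ℕ) → .{{NonZero R}} →
        (∀ (I : Subset n) → ∣ I ∣ ≡ k → ∀ h → ∑ rows (close (build ins Q₀ I h)) ≤ N) →
        (n C k) * (n C s) * N ^ s < R ^ s →
        Σ (Vec A n) λ h → ∀ (I J : Subset n) → ∣ I ∣ ≡ k → ∣ J ∣ ≡ s → event I J h (build ins Q₀ I h) ≡ 0
      good-configuration d N hN few = h , no-bad-pair
        where
        fewer : ∑ (vectors rows n) badness < length (vectors rows n)
        fewer = *-cancelʳ-< (R ^ s) _ _ (begin-strict
          ∑ (vectors rows n) badness * R ^ s    ≤⟨ badness-total d N hN ⟩
          (n C k) * (n C s) * (N ^ s * R ^ n)       ≡⟨ sym (*-assoc ((n C k) * (n C s)) (N ^ s) (R ^ n)) ⟩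
          (n C k) * (n C s) * N ^ s * R ^ n         <⟨ *-monoˡ-< (R ^ n) {{m^n≢0 R n}} few ⟩
          R ^ s * R ^ n                         ≡⟨ *-comm (R ^ s) (R ^ n) ⟩
          R ^ n * R ^ s                         ≡⟨ cong (_* R ^ s) (sym (length-vectors rows n)) ⟩
          length (vectors rows n) * R ^ s       ∎)
          where open ≤-Reasoning
        h = Σ.proj₁ (∑<length⇒zero (vectors rows n) badness fewer)
        no-bad-pair : ∀ (I J : Subset n) → ∣ I ∣ ≡ k → ∣ J ∣ ≡ s → event I J h (build ins Q₀ I h) ≡ 0
        no-bad-pair I J ∣I∣≡k ∣J∣≡s = n≤0⇒n≡0 (begin
          event I J h (build ins Q₀ I h)
            ≡⟨ sym (+-identityʳ _) ⟩
          1 * event I J h (build ins Q₀ I h)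
            ≡⟨ cong (_* event I J h (build ins Q₀ I h)) (sym selected) ⟩
          𝟙 ((∣ I ∣ ≡ᵇ k) ∧ (∣ J ∣ ≡ᵇ s)) * event I J h (build ins Q₀ I h)
            ≤⟨ ∈⇒≤∑ (vectors Bools n) _ (∈-vectors Bools ∈-Bools J) ⟩
          ∑[ J′ ← vectors Bools n ] (𝟙 ((∣ I ∣ ≡ᵇ k) ∧ (∣ J′ ∣ ≡ᵇ s)) * event I J′ h (build ins Q₀ I h))
            ≤⟨ ∈⇒≤∑ (vectors Bools n) _ (∈-vectors Bools ∈-Bools I) ⟩
          badness h
            ≡⟨ Σ.proj₂ (∑<length⇒zero (vectors rows n) badness fewer) ⟩
          0 ∎)
          where
          open ≤-Reasoning
          selected : 𝟙 ((∣ I ∣ ≡ᵇ k) ∧ (∣ J ∣ ≡ᵇ s)) ≡ 1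
          selected rewrite ∣I∣≡k | ∣J∣≡s | ≡ᵇ-refl k | ≡ᵇ-refl s = refl

module BlockCode where

  open import Data.Nat using (ℕ; zero; suc; _+_; _*_; _≤_; z≤n; s≤s)
  open import Data.Nat.Properties
  open import Data.Nat.Tactic.RingSolver using (solve-∀)
  open import Data.Bool using (Bool; true; false; if_then_else_; _∨_)
  open import Data.Bool.Properties using (∨-zeroʳ)
  open import Data.Fin using (Fin; zero; suc)
  open import Data.Fin.Subset using (Subset; _∈_; _∪_; ∣_∣; ⁅_⁆; ⊥)
  open import Data.Fin.Subset.Properties using (x∈⁅x⁆; ∣⁅x⁆∣≡1; ∣⊥∣≡0)
  open import Data.Vec using (Vec; []; _∷_; lookup; concat; map; zipWith; replicate; _++_; here; there)
  open import Data.Vec.Properties using ([]=⇒lookup; lookup-zipWith)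
  open import Data.Vec.Relation.Unary.All using (All; []; _∷_)
  open import Relation.Binary.PropositionalEquality
  open import Defs using (hamming)
  open SubsetCounting using (∣p∪q∣≤∣p∣+∣q∣)
  open UnionBound using (build)

  -- A row is a word of length L over the alphabet Fin B; it is embedded into {0,1}^(L·B)
  -- by writing every letter in one-hot form.  A query is a list of L subsets of the
  -- alphabet, embedded into {0,1}^(L·B) as the concatenation of their indicator vectors.
  Row : ℕ → ℕ → Set
  Row B L = Vec (Fin B) L

  Query : ℕ → ℕ → Set
  Query B L = Vec (Subset B) L

  encode : ∀ {B L} → Row B L → Vec Bool (L * B)
  encode r = concat (map ⁅_⁆ r)

  blockMiss : ∀ {B} → Fin B → Subset B → ℕ
  blockMiss x q = if lookup q x then 0 else 1

  misses : ∀ {B L} → Row B L → Query B L → ℕ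
  misses []      []      = 0
  misses (x ∷ r) (q ∷ Q) = blockMiss x q + misses r Q

  size : ∀ {B L} → Query B L → ℕ
  size []      = 0
  size (q ∷ Q) = ∣ q ∣ + size Q

  hamming-++ : ∀ {a b} (xs us : Vec Bool a) (ys vs : Vec Bool b) →
               hamming (xs ++ ys) (us ++ vs) ≡ hamming xs us + hamming ys vs
  hamming-++ []       []       ys vs = refl
  hamming-++ (x ∷ xs) (u ∷ us) ys vs =
    trans (cong (_ +_) (hamming-++ xs us ys vs)) (sym (+-assoc _ (hamming xs us) (hamming ys vs)))

  hamming-⊥ : ∀ {B} (q : Subset B) → hamming ⊥ q ≡ ∣ q ∣
  hamming-⊥ []          = refl
  hamming-⊥ (true ∷ q)  = cong suc (hamming-⊥ q)
  hamming-⊥ (false ∷ q) = hamming-⊥ q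

  hamming-⁅⁆ : ∀ {B} (x : Fin B) (q : Subset B) → hamming ⁅ x ⁆ q + 1 ≡ ∣ q ∣ + 2 * blockMiss x q
  hamming-⁅⁆ zero    (true ∷ q)  rewrite hamming-⊥ q = trans (+-comm ∣ q ∣ 1) (sym (+-identityʳ (suc ∣ q ∣)))
  hamming-⁅⁆ zero    (false ∷ q) rewrite hamming-⊥ q = sym (+-suc ∣ q ∣ 1)
  hamming-⁅⁆ (suc x) (true ∷ q)  = cong suc (hamming-⁅⁆ x q)
  hamming-⁅⁆ (suc x) (false ∷ q) = hamming-⁅⁆ x q

  distance-formula : ∀ {B L} (r : Row B L) (Q : Query B L) →
                     hamming (encode r) (concat Q) + L ≡ size Q + 2 * misses r Q
  distance-formula []      []      = refl
  distance-formula {L = suc L} (x ∷ r) (q ∷ Q) = begin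
    hamming (⁅ x ⁆ ++ encode r) (q ++ concat Q) + suc L
      ≡⟨ cong (_+ suc L) (hamming-++ ⁅ x ⁆ q (encode r) (concat Q)) ⟩
    hamming ⁅ x ⁆ q + hamming (encode r) (concat Q) + suc L
      ≡⟨ regroup (hamming ⁅ x ⁆ q) (hamming (encode r) (concat Q)) L ⟩
    (hamming ⁅ x ⁆ q + 1) + (hamming (encode r) (concat Q) + L)
      ≡⟨ cong₂ _+_ (hamming-⁅⁆ x q) (distance-formula r Q) ⟩
    (∣ q ∣ + 2 * blockMiss x q) + (size Q + 2 * misses r Q)
      ≡⟨ regroup′ ∣ q ∣ (blockMiss x q) (size Q) (misses r Q) ⟩
    ∣ q ∣ + size Q + 2 * (blockMiss x q + misses r Q) ∎
    where
    open ≡-Reasoning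
    regroup : ∀ a b L → a + b + (1 + L) ≡ (a + 1) + (b + L)
    regroup = solve-∀
    regroup′ : ∀ a m s n → (a + 2 * m) + (s + 2 * n) ≡ a + s + 2 * (m + n)
    regroup′ = solve-∀

  insert : ∀ {B L} → Row B L → Query B L → Query B L
  insert = zipWith (λ x q → ⁅ x ⁆ ∪ q)

  query : ∀ {B L n} → Query B L → Subset n → Vec (Row B L) n → Query B L
  query = build insert

  blockMiss-∪ : ∀ {B} (x y : Fin B) (q : Subset B) → blockMiss x (⁅ y ⁆ ∪ q) ≤ blockMiss x q
  blockMiss-∪ x y q rewrite lookup-zipWith _∨_ x ⁅ y ⁆ q with lookup q x
  ... | true  rewrite ∨-zeroʳ (lookup ⁅ y ⁆ x) = z≤n
  ... | false = at-most-one (lookup ⁅ y ⁆ x ∨ false)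
    where
    at-most-one : ∀ b → (if b then 0 else 1) ≤ 1
    at-most-one true  = z≤n
    at-most-one false = s≤s z≤n

  misses-insert : ∀ {B L} (r y : Row B L) (Q : Query B L) → misses r (insert y Q) ≤ misses r Q
  misses-insert []      []      []      = z≤n
  misses-insert (x ∷ r) (y ∷ s) (q ∷ Q) = +-mono-≤ (blockMiss-∪ x y q) (misses-insert r s Q)

  misses-query : ∀ {B L n} (r : Row B L) (Q : Query B L) (I : Subset n) (h : Vec (Row B L) n) →
                 misses r (query Q I h) ≤ misses r Q
  misses-query r Q []          []      = ≤-refl
  misses-query r Q (true ∷ I)  (y ∷ h) = ≤-trans (misses-query r (insert y Q) I h) (misses-insert r y Q)
  misses-query r Q (false ∷ I) (y ∷ h) = misses-query r Q I h

  misses-insert-self : ∀ {B L} (r : Row B L) (Q : Query B L) → misses r (insert r Q) ≡ 0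
  misses-insert-self []      []      = refl
  misses-insert-self (x ∷ r) (q ∷ Q)
    rewrite lookup-zipWith _∨_ x ⁅ x ⁆ q | []=⇒lookup (x∈⁅x⁆ x) = misses-insert-self r Q

  misses-member : ∀ {B L n} (Q : Query B L) (I : Subset n) (h : Vec (Row B L) n) {i : Fin n} →
                  i ∈ I → misses (lookup h i) (query Q I h) ≡ 0
  misses-member Q (true ∷ I)  (r ∷ h) here        =
    n≤0⇒n≡0 (≤-trans (misses-query r (insert r Q) I h) (≤-reflexive (misses-insert-self r Q)))
  misses-member Q (true ∷ I)  (r ∷ h) (there i∈I) = misses-member (insert r Q) I h i∈I
  misses-member Q (false ∷ I) (r ∷ h) (there i∈I) = misses-member Q I h i∈I

  BlocksAtMost : ∀ {B L} → ℕ → Query B L → Set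
  BlocksAtMost m Q = All (λ q → ∣ q ∣ ≤ m) Q

  blocks-insert : ∀ {B L m} (r : Row B L) (Q : Query B L) → BlocksAtMost m Q → BlocksAtMost (suc m) (insert r Q)
  blocks-insert []      []      []         = []
  blocks-insert {m = m} (x ∷ r) (q ∷ Q) (q≤ ∷ Q≤) =
    ≤-trans (∣p∪q∣≤∣p∣+∣q∣ ⁅ x ⁆ q) (subst (λ a → a + ∣ q ∣ ≤ suc m) (sym (∣⁅x⁆∣≡1 x)) (s≤s q≤))
    ∷ blocks-insert r Q Q≤

  blocks-query : ∀ {B L n m} (Q : Query B L) (I : Subset n) (h : Vec (Row B L) n) →
                 BlocksAtMost m Q → BlocksAtMost (m + ∣ I ∣) (query Q I h)
  blocks-query {m = m} Q []          []      Q≤ = subst (λ k → BlocksAtMost k Q) (sym (+-identityʳ m)) Q≤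
  blocks-query {m = m} Q (true ∷ I)  (r ∷ h) Q≤ = subst (λ k → BlocksAtMost k (query (insert r Q) I h))
    (sym (+-suc m ∣ I ∣)) (blocks-query (insert r Q) I h (blocks-insert r Q Q≤))
  blocks-query         Q (false ∷ I) (r ∷ h) Q≤ = blocks-query Q I h Q≤

  blocks-empty : ∀ {B L} → BlocksAtMost 0 (replicate L (⊥ {B}))
  blocks-empty {B} {zero}  = []
  blocks-empty {B} {suc L} = ≤-reflexive (∣⊥∣≡0 B) ∷ blocks-empty

  size-bound : ∀ {B L m} (Q : Query B L) → BlocksAtMost m Q → size Q ≤ L * m
  size-bound []      []         = z≤n
  size-bound (q ∷ Q) (q≤ ∷ Q≤) = +-mono-≤ q≤ (size-bound Q Q≤)

module NearRows where

  open import Data.Nat using (ℕ; zero; suc; _+_; _*_; _^_; _≤_; z≤n; s≤s)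
  open import Data.Nat.Properties
  open import Data.Nat.Tactic.RingSolver using (solve-∀)
  open import Data.Bool using (Bool; true; false; if_then_else_)
  open import Data.Fin using (Fin; zero; suc)
  open import Data.Fin.Subset using (Subset; ∣_∣)
  open import Data.Vec using (Vec; []; _∷_; lookup)
  open import Data.Vec.Relation.Unary.All using ([]; _∷_)
  open import Data.List using (List; allFin)
  open import Relation.Binary.PropositionalEquality
  open FiniteSums
  open SubsetCounting using (𝟙)
  open BlockCode

  mutual
    near : ∀ {B L} → ℕ → Row B L → Query B L → Bool
    near m []      []      = true
    near m (x ∷ r) (q ∷ Q) = if lookup q x then near m r Q else nearAfterMiss m r Q

    nearAfterMiss : ∀ {B L} → ℕ → Row B L → Query B L → Bool
    nearAfterMiss zero    r Q = false
    nearAfterMiss (suc m) r Q = near m r Q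

  misses≤⇒near : ∀ {B L} m (r : Row B L) (Q : Query B L) → misses r Q ≤ m → near m r Q ≡ true
  misses≤⇒near m       []      []      _ = refl
  misses≤⇒near m       (x ∷ r) (q ∷ Q) r≤ with lookup q x
  misses≤⇒near m       (x ∷ r) (q ∷ Q) r≤       | true  = misses≤⇒near m r Q r≤
  misses≤⇒near (suc m) (x ∷ r) (q ∷ Q) (s≤s r≤) | false = misses≤⇒near m r Q r≤

  rows : ∀ B L → List (Row B L)
  rows B L = vectors (allFin B) L

  ∑-choice : ∀ {B} (q : Subset B) (a b : ℕ) →
             ∑[ x ← allFin B ] (if lookup q x then a else b) ≤ ∣ q ∣ * a + B * b
  ∑-choice []          a b = z≤n
  ∑-choice {suc B} (true ∷ q)  a b rewrite ∑-allFin-suc (λ x → if lookup (true ∷ q) x then a else b) = begin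
    a + ∑[ x ← allFin B ] (if lookup q x then a else b) ≤⟨ +-monoʳ-≤ a (∑-choice q a b) ⟩
    a + (∣ q ∣ * a + B * b)                               ≤⟨ ≤-reflexive (sym (+-assoc a (∣ q ∣ * a) (B * b))) ⟩
    a + ∣ q ∣ * a + B * b                                 ≤⟨ +-monoʳ-≤ (a + ∣ q ∣ * a) (m≤n+m (B * b) b) ⟩
    a + ∣ q ∣ * a + (b + B * b)                           ∎
    where open ≤-Reasoning
  ∑-choice {suc B} (false ∷ q) a b rewrite ∑-allFin-suc (λ x → if lookup (false ∷ q) x then a else b) = begin
    b + ∑[ x ← allFin B ] (if lookup q x then a else b) ≤⟨ +-monoʳ-≤ b (∑-choice q a b) ⟩
    b + (∣ q ∣ * a + B * b)                               ≡⟨ swap b (∣ q ∣ * a) (B * b) ⟩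
    ∣ q ∣ * a + (b + B * b)                               ∎
    where
    open ≤-Reasoning
    swap : ∀ x y z → x + (y + z) ≡ y + (x + z)
    swap = solve-∀

  -- If every block of Q has at most k of the B ≤ 4k letters, then at most (2k)^L · 4^m rows
  -- miss at most m blocks: a miss can be placed in 4k ways but costs a factor 4 in the bound,
  -- a hit can be placed in k ways.
  near-count : ∀ {B k} → B ≤ 4 * k → ∀ {L} (Q : Query B L) → BlocksAtMost k Q → ∀ m →
               ∑[ r ← rows B L ] 𝟙 (near m r Q) ≤ (2 * k) ^ L * 4 ^ m
  near-count B≤4k {zero} [] [] m = ≤-trans (m^n>0 4 m) (≤-reflexive (sym (*-identityˡ (4 ^ m))))
  near-count {B} {k} B≤4k {suc L} (q ∷ Q) (q≤k ∷ Q≤k) m = begin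
    ∑[ r ← rows B (suc L) ] 𝟙 (near m r (q ∷ Q))
      ≡⟨ ∑-vectors (allFin B) L (λ r → 𝟙 (near m r (q ∷ Q))) ⟩
    ∑[ x ← allFin B ] ∑[ r ← rows B L ] 𝟙 (near m (x ∷ r) (q ∷ Q))
      ≤⟨ ∑-mono (allFin B) (column m) ⟩
    ∑[ x ← allFin B ] (if lookup q x then F m else G m)
      ≤⟨ ∑-choice q (F m) (G m) ⟩
    ∣ q ∣ * F m + B * G m
      ≤⟨ +-mono-≤ (*-monoˡ-≤ (F m) q≤k) (*-monoˡ-≤ (G m) B≤4k) ⟩
    k * F m + 4 * k * G m
      ≤⟨ +-monoʳ-≤ (k * F m) (4G≤F m) ⟩
    k * F m + k * F m
      ≡⟨ double k ((2 * k) ^ L) (4 ^ m) ⟩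
    (2 * k) ^ suc L * 4 ^ m ∎
    where
    open ≤-Reasoning
    F : ℕ → ℕ
    F m = (2 * k) ^ L * 4 ^ m
    -- the bound for the remaining blocks after a miss
    G : ℕ → ℕ
    G zero    = 0
    G (suc m) = F m
    column : ∀ m x → ∑[ r ← rows B L ] 𝟙 (near m (x ∷ r) (q ∷ Q)) ≤ (if lookup q x then F m else G m)
    column m x with lookup q x
    column m       x | true  = near-count B≤4k Q Q≤k m
    column zero    x | false = ≤-reflexive (∑-zero (rows B L))
    column (suc m) x | false = near-count B≤4k Q Q≤k m
    4G≤F : ∀ m → 4 * k * G m ≤ k * F m
    4G≤F zero    = subst (_≤ k * F zero) (sym (*-zeroʳ (4 * k))) z≤n
    4G≤F (suc m) = ≤-reflexive (shift k ((2 * k) ^ L) (4 ^ m))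
      where
      shift : ∀ k x y → 4 * k * (x * y) ≡ k * (x * (4 * y))
      shift = solve-∀
    double : ∀ k x y → k * (x * y) + k * (x * y) ≡ 2 * k * x * y
    double = solve-∀

module KthNearest where

  open import Data.Nat using (ℕ; zero; suc; _≤_; _≤?_; z≤n; s≤s)
  open import Data.Nat.Properties
  open import Data.Bool using (Bool; true; false)
  open import Data.Fin using (Fin; zero; suc)
  open import Data.Fin.Subset using (Subset; _∈_; ∣_∣)
  open import Data.Vec using (Vec; []; _∷_; here; there)
  open import Data.List using (List; []; _∷_; length; filter; tabulate)
  open import Data.List.Properties using (filter-accept; filter-reject; filter-none; map-tabulate)
  import Data.List.Relation.Unary.All as All
  open import Data.List.Relation.Unary.Linked using (Linked; _∷_)
  open import Data.List.Relation.Unary.Linked.Properties using (Linked⇒All)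
  open import Data.List.Relation.Binary.Permutation.Propositional.Properties using (filter-↭; ↭-length)
  open import Data.List.Sort ≤-decTotalOrder using (sort; sort-↭; sort-↗)
  open import Relation.Nullary using (yes; no; contradiction)
  open import Relation.Binary.PropositionalEquality
  open import Defs

  atMost : ℕ → List ℕ → ℕ
  atMost D xs = length (filter (_≤? D) xs)

  nth-sorted : ∀ D (ys : List ℕ) → Linked _≤_ ys → ∀ j → suc j ≤ atMost D ys → nth ys j ≤ D
  nth-sorted D (y ∷ ys) sorted j j<count with y ≤? D
  ... | no y≰D = contradiction (subst (suc j ≤_) nothing-small j<count) λ ()
    where
    nothing-small : atMost D (y ∷ ys) ≡ 0
    nothing-small = cong length (filter-none (_≤? D)
      (All.map (λ y≤x x≤D → y≰D (≤-trans y≤x x≤D)) (Linked⇒All ≤-trans ≤-refl sorted)))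
  ... | yes y≤D with j | ys | sorted | subst (suc j ≤_) (cong length (filter-accept (_≤? D) y≤D)) j<count
  ...   | zero  | _      | _              | _          = y≤D
  ...   | suc i | z ∷ zs | _ ∷ sorted-tail | s≤s i<count = nth-sorted D (z ∷ zs) sorted-tail i i<count

  atMost-tabulate : ∀ {n} D (g : Fin n → ℕ) (I : Subset n) →
                    (∀ i → i ∈ I → g i ≤ D) → ∣ I ∣ ≤ atMost D (tabulate g)
  atMost-tabulate D g []          _     = z≤n
  atMost-tabulate D g (b ∷ I)     close with g zero ≤? D
  ... | yes g0≤D = ≤-trans (∣b∷I∣≤1+∣I∣ b)
    (≤-trans (s≤s (atMost-tabulate D (λ i → g (suc i)) I (λ i i∈I → close (suc i) (there i∈I)))) (≤-reflexive (sym (cong length (filter-accept (_≤? D) g0≤D)))))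
    where
    ∣b∷I∣≤1+∣I∣ : ∀ b → ∣ b ∷ I ∣ ≤ suc ∣ I ∣
    ∣b∷I∣≤1+∣I∣ true  = ≤-refl
    ∣b∷I∣≤1+∣I∣ false = n≤1+n ∣ I ∣
  atMost-tabulate D g (true ∷ I)  close | no g0≰D = contradiction (close zero here) g0≰D
  atMost-tabulate D g (false ∷ I) close | no g0≰D =
    ≤-trans (atMost-tabulate D (λ i → g (suc i)) I (λ i i∈I → close (suc i) (there i∈I))) (≤-reflexive (sym (cong length (filter-reject (_≤? D) g0≰D))))

  kthNNDist≤ : ∀ {n d} (p : Fin n → Vec Bool d) (q : Vec Bool d) (I : Subset n) (k D : ℕ) →
               ∣ I ∣ ≡ k → 1 ≤ k → (∀ i → i ∈ I → hamming (p i) q ≤ D) → kthNNDist k p q ≤ D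
  kthNNDist≤ {n} p q I (suc j) D ∣I∣≡k _ close =
    nth-sorted D (sort (dists p q)) (sort-↗ (dists p q)) j (begin
      suc j                                           ≡⟨ sym ∣I∣≡k ⟩
      ∣ I ∣                                           ≤⟨ atMost-tabulate D distance I close ⟩
      atMost D (tabulate distance)                    ≡⟨ cong (atMost D) (sym (map-tabulate (λ i → i) distance)) ⟩
      atMost D (dists p q)                            ≡⟨ sym (↭-length (filter-↭ (_≤? D) (sort-↭ (dists p q)))) ⟩
      atMost D (sort (dists p q))                     ∎)
    where
    open ≤-Reasoning
    distance : Fin n → ℕ
    distance i = hamming (p i) q

module Separations where

  open import Data.Nat using (ℕ; zero; suc; _+_; _*_; _∸_; _^_; _≤_; _<_)
  open import Data.Nat.Properties
  open import Data.Nat.Tactic.RingSolver using (solve-∀)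
  open import Data.Bool using (Bool)
  open import Data.Fin using (Fin)
  open import Data.Fin.Subset using (Subset; _∈_; _∉_; _⊆_; _∩_; _∪_; ∣_∣)
  open import Data.Fin.Subset.Properties using (_∈?_; p⊆p∪q)
  open import Data.Vec using (Vec)
  open import Data.Product using (Σ; _×_; _,_)
  open import Data.Empty using (⊥; ⊥-elim)
  open import Relation.Nullary using (yes; no; contradiction)
  open import Relation.Binary.PropositionalEquality
  open import Defs
  open SubsetCounting using (covered-size; ∣p∪q∣≤∣p∣+∣q∣)
  open KthNearest using (kthNNDist≤)

  record Separation {n d : ℕ} (k : ℕ) (p : Fin n → Vec Bool d) (I : Subset n) : Set where
    field
      centre      : Vec Bool d
      radius      : ℕ
      extra       : Subset n
      extra-small : 2 * ∣ extra ∣ ≤ k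
      inside      : ∀ i → i ∈ I → hamming (p i) centre ≤ radius
      outside     : ∀ i → i ∉ I ∪ extra → radius * (4 * k ∸ 3) ≤ 4 * (k ∸ 1) * hamming (p i) centre
      outside-pos : ∀ i → i ∉ I ∪ extra → 0 < hamming (p i) centre

  far-points-excluded : ∀ a b r h K → 0 < b → 0 < h → a * K < b * suc K →
                        r * suc K ≤ K * h → b * h ≤ a * r → ⊥
  far-points-excluded a b zero    h K 0<b 0<h _ _ bh≤0 =
    contradiction (≤-trans (*-mono-≤ 0<b 0<h) (≤-trans bh≤0 (≤-reflexive (*-zeroʳ a)))) λ ()
  far-points-excluded a b r@(suc _) h K 0<b 0<h aK<b[K+1] r[K+1]≤Kh bh≤ar =
    <-irrefl refl (begin-strict
      a * K * r        <⟨ *-monoˡ-< r aK<b[K+1] ⟩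
      b * suc K * r    ≡⟨ *-assoc b (suc K) r ⟩
      b * (suc K * r)  ≡⟨ cong (b *_) (*-comm (suc K) r) ⟩
      b * (r * suc K)  ≤⟨ *-monoʳ-≤ b r[K+1]≤Kh ⟩
      b * (K * h)      ≡⟨ exchange b K h ⟩
      K * (b * h)      ≤⟨ *-monoʳ-≤ K bh≤ar ⟩
      K * (a * r)      ≡⟨ exchange′ K a r ⟩
      a * K * r        ∎)
    where
    open ≤-Reasoning
    exchange : ∀ x y z → x * (y * z) ≡ y * (x * z)
    exchange = solve-∀
    exchange′ : ∀ x y z → x * (y * z) ≡ y * x * z
    exchange′ = solve-∀

  4k∸3≡1+4[k∸1] : ∀ k → 1 ≤ k → 4 * k ∸ 3 ≡ suc (4 * (k ∸ 1))
  4k∸3≡1+4[k∸1] (suc k) _ = cong (_∸ 3) (*-suc 4 k)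

  majority-bound : ∀ k x y → k ≤ x + y → 2 * y ≤ k → k ≤ 2 * x
  majority-bound k x y k≤x+y 2y≤k = +-cancelʳ-≤ k k (2 * x) (begin
    k + k            ≡⟨ cong (k +_) (sym (+-identityʳ k)) ⟩
    2 * k            ≤⟨ *-monoʳ-≤ 2 k≤x+y ⟩
    2 * (x + y)      ≡⟨ *-distribˡ-+ 2 x y ⟩
    2 * x + 2 * y    ≤⟨ +-monoʳ-≤ (2 * x) 2y≤k ⟩
    2 * x + k        ∎)
    where open ≤-Reasoning

  NNGuarantee : ∀ {n d} (k : ℕ) (p : Fin n → Vec Bool d) (I : Subset n) → Set
  NNGuarantee {n} {d} k p I =
    Σ (Vec Bool d) λ q → Σ ℕ λ dI → Σ (Subset n) λ I′ →
      (I ⊆ I′) × (2 * ∣ I′ ∣ ≤ 3 * k) ×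
      (∀ i → i ∈ I → hamming (p i) q ≤ dI) ×
      (∀ i → i ∉ I′ → dI * (4 * k ∸ 3) ≤ (4 * (k ∸ 1)) * hamming (p i) q) ×
      (∀ (a b : ℕ) → 0 < b → a * (4 * (k ∸ 1)) < b * (4 * k ∸ 3) →
        ∀ (S : Subset n) → ValidNN a b k p q S →
        (S ⊆ I′) × (k ≤ 2 * ∣ S ∩ I ∣))

  -- n points in dimension d = O(k log(n/k)) (with constant C) with the guarantee for all k-sets
  NNCode : (C n k : ℕ) → Set
  NNCode C n k = Σ ℕ λ d → (2 ^ d * k ^ (C * k) ≤ n ^ (C * k)) ×
    Σ (Fin n → Vec Bool d) λ p → ∀ (I : Subset n) → ∣ I ∣ ≡ k → NNGuarantee k p I

  -- A separation yields the guarantee with I′ = I ∪ extra: valid answers cannot use far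
  -- points, so they lie in I′, and at most k/2 of them lie outside I.
  separation⇒guarantee : ∀ {n d k} (p : Fin n → Vec Bool d) (I : Subset n) →
                         ∣ I ∣ ≡ k → 1 ≤ k → Separation k p I → NNGuarantee k p I
  separation⇒guarantee {k = k} p I ∣I∣≡k 1≤k sep =
    centre , radius , I ∪ extra , p⊆p∪q extra , size-I′ , inside , outside , valid-answers
    where
    open Separation sep
    size-I′ : 2 * ∣ I ∪ extra ∣ ≤ 3 * k
    size-I′ = begin
      2 * ∣ I ∪ extra ∣           ≤⟨ *-monoʳ-≤ 2 (∣p∪q∣≤∣p∣+∣q∣ I extra) ⟩
      2 * (∣ I ∣ + ∣ extra ∣)     ≡⟨ cong (λ m → 2 * (m + ∣ extra ∣)) ∣I∣≡k ⟩
      2 * (k + ∣ extra ∣)         ≡⟨ *-distribˡ-+ 2 k ∣ extra ∣ ⟩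
      2 * k + 2 * ∣ extra ∣       ≤⟨ +-monoʳ-≤ (2 * k) extra-small ⟩
      2 * k + k                   ≡⟨ +-comm (2 * k) k ⟩
      3 * k                       ∎
      where open ≤-Reasoning
    valid-answers : ∀ (a b : ℕ) → 0 < b → a * (4 * (k ∸ 1)) < b * (4 * k ∸ 3) →
                    ∀ (S : Subset _) → ValidNN a b k p centre S →
                    (S ⊆ I ∪ extra) × (k ≤ 2 * ∣ S ∩ I ∣)
    valid-answers a b 0<b ratio S (∣S∣≡k , S-close) = S⊆I′ , majority
      where
      kth≤radius : kthNNDist k p centre ≤ radius
      kth≤radius = kthNNDist≤ p centre I k radius ∣I∣≡k 1≤k inside
      S⊆I′ : S ⊆ I ∪ extra
      S⊆I′ {x} x∈S with x ∈? (I ∪ extra)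
      ... | yes x∈I′ = x∈I′
      ... | no  x∉I′ = ⊥-elim (far-points-excluded a b radius (hamming (p x) centre) (4 * (k ∸ 1))
        0<b (outside-pos x x∉I′)
        (subst (λ m → a * (4 * (k ∸ 1)) < b * m) (4k∸3≡1+4[k∸1] k 1≤k) ratio)
        (subst (λ m → radius * m ≤ 4 * (k ∸ 1) * hamming (p x) centre) (4k∸3≡1+4[k∸1] k 1≤k) (outside x x∉I′))
        (≤-trans (S-close x x∈S) (*-monoʳ-≤ a kth≤radius)))
      majority : k ≤ 2 * ∣ S ∩ I ∣
      majority = majority-bound k ∣ S ∩ I ∣ ∣ extra ∣
        (subst (_≤ ∣ S ∩ I ∣ + ∣ extra ∣) ∣S∣≡k (covered-size S I extra S⊆I′)) extra-small

module Parameters where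

  open import Data.Nat using (ℕ; zero; suc; _+_; _*_; _^_; _≤_; _<_; _≤?_; z≤n; s≤s; NonZero; >-nonZero)
  open import Data.Nat.Properties
  open import Data.Nat.Combinatorics using (_C_)
  open import Data.Nat.Tactic.RingSolver using (solve-∀)
  open import Data.Product using (Σ; _×_; _,_)
  open import Relation.Nullary using (yes; no; contradiction)
  open import Relation.Binary.PropositionalEquality
  open BinomialEstimates using (*-^-distrib; binomial-bound)

  power-between : ∀ a b → 1 ≤ b → b ≤ a → Σ ℕ λ t → a ≤ 2 ^ t * b × 2 ^ t * b ≤ 2 * a
  power-between a b 1≤b b≤a = double a b 1≤b (≤-trans b≤a (m≤m+n a (a + 0))) (m≤m+n a b)
    where
    double : ∀ fuel b → 1 ≤ b → b ≤ 2 * a → a ≤ fuel + b → Σ ℕ λ t → a ≤ 2 ^ t * b × 2 ^ t * b ≤ 2 * a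
    double fuel b 1≤b b≤2a a≤fuel+b with a ≤? b
    ... | yes a≤b = 0 , subst (a ≤_) (sym (*-identityˡ b)) a≤b , subst (_≤ 2 * a) (sym (*-identityˡ b)) b≤2a
    double zero       b 1≤b b≤2a a≤b | no a≰b = contradiction a≤b a≰b
    double (suc fuel) b 1≤b b≤2a a≤1+fuel+b | no a≰b
      with double fuel (2 * b) (≤-trans 1≤b (m≤m+n b (b + 0))) (*-monoʳ-≤ 2 (<⇒≤ (≰⇒> a≰b)))
                  (≤-trans a≤1+fuel+b (≤-trans (≤-reflexive (sym (+-suc fuel b)))
                    (+-monoʳ-≤ fuel (≤-trans (+-monoˡ-≤ b 1≤b) (≤-reflexive (cong (b +_) (sym (+-identityʳ b))))))))
    ... | t , a≤ , ≤2a = suc t , subst (a ≤_) (regroup (2 ^ t) b) a≤ , subst (_≤ 2 * a) (regroup (2 ^ t) b) ≤2a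
      where
      regroup : ∀ x b → x * (2 * b) ≡ 2 * x * b
      regroup = solve-∀

  -- With 16n ≤ 2^t·k and k ≤ 2s, the number of pairs of index sets of sizes k and s times the
  -- weight N^s of a single bad pair is below R^s, for rows of length 8t over 4k letters and
  -- threshold thr ≤ t.
  union-bound-inequality : ∀ n k s t thr → 16 * n ≤ 2 ^ t * k → k ≤ 2 * s → 1 ≤ s → 1 ≤ t → 1 ≤ k → thr ≤ t →
    (n C k) * (n C s) * ((2 * k) ^ (8 * t) * 4 ^ thr) ^ s < ((4 * k) ^ (8 * t)) ^ s
  union-bound-inequality n k s t thr 16n≤2^tk k≤2s 1≤s 1≤t 1≤k thr≤t = begin-strict
    (n C k) * (n C s) * N ^ s
      ≤⟨ *-monoˡ-≤ (N ^ s) (*-mono-≤ (binomial-bound n k t 8n≤2^tk) (binomial-bound n s t 8n≤2^ts)) ⟩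
    2 ^ (t * k) * 2 ^ (t * s) * N ^ s
      ≡⟨ cong (_* N ^ s) (sym (^-distribˡ-+-* 2 (t * k) (t * s))) ⟩
    2 ^ (t * k + t * s) * N ^ s
      <⟨ *-monoˡ-< (N ^ s) {{m^n≢0 N s {{N≢0}}}} (^-monoʳ-< 2 (s≤s (s≤s z≤n)) exponent<) ⟩
    2 ^ (6 * t * s) * N ^ s
      ≡⟨ trans (cong (_* N ^ s) (sym (^-*-assoc 2 (6 * t) s))) (sym (*-^-distrib (2 ^ (6 * t)) N s)) ⟩
    (2 ^ (6 * t) * N) ^ s
      ≤⟨ ^-monoˡ-≤ s per-row ⟩
    ((4 * k) ^ (8 * t)) ^ s ∎
    where
    open ≤-Reasoning
    N : ℕ
    N = (2 * k) ^ (8 * t) * 4 ^ thr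
    N≢0 : NonZero N
    N≢0 = m*n≢0 _ _ {{m^n≢0 (2 * k) (8 * t) {{>-nonZero (≤-trans 1≤k (m≤m+n k (k + 0)))}}}} {{m^n≢0 4 thr}}
    8n≤2^tk : 8 * n ≤ 2 ^ t * k
    8n≤2^tk = ≤-trans (*-monoˡ-≤ n (≤ᵇ⇒≤ 8 16 _)) 16n≤2^tk
    8n≤2^ts : 8 * n ≤ 2 ^ t * s
    8n≤2^ts = *-cancelˡ-≤ 2 (begin
      2 * (8 * n)       ≡⟨ sym (*-assoc 2 8 n) ⟩
      16 * n            ≤⟨ 16n≤2^tk ⟩
      2 ^ t * k         ≤⟨ *-monoʳ-≤ (2 ^ t) k≤2s ⟩
      2 ^ t * (2 * s)   ≡⟨ x*[y*z]≡y*[x*z] (2 ^ t) 2 s ⟩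
      2 * (2 ^ t * s)   ∎)
      where
      x*[y*z]≡y*[x*z] : ∀ x y z → x * (y * z) ≡ y * (x * z)
      x*[y*z]≡y*[x*z] = solve-∀
    exponent< : t * k + t * s < 6 * t * s
    exponent< = begin-strict
      t * k + t * s        ≤⟨ +-monoˡ-≤ (t * s) (*-monoʳ-≤ t k≤2s) ⟩
      t * (2 * s) + t * s  ≡⟨ three t s ⟩
      3 * (t * s)          <⟨ *-monoˡ-< (t * s) {{>-nonZero (*-mono-≤ 1≤t 1≤s)}} (≤ᵇ⇒≤ 4 6 _) ⟩
      6 * (t * s)          ≡⟨ sym (*-assoc 6 t s) ⟩
      6 * t * s            ∎
      where
      three : ∀ t s → t * (2 * s) + t * s ≡ 3 * (t * s)
      three = solve-∀
    -- a single row: 2^(6t) · (2k)^(8t) · 4^thr ≤ 2^(6t) · 2^(8t) · k^(8t) · 2^(2t) = (4k)^(8t)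
    per-row : 2 ^ (6 * t) * N ≤ (4 * k) ^ (8 * t)
    per-row = begin
      2 ^ (6 * t) * ((2 * k) ^ (8 * t) * 4 ^ thr)
        ≤⟨ *-monoʳ-≤ (2 ^ (6 * t)) (*-monoʳ-≤ ((2 * k) ^ (8 * t)) (^-monoʳ-≤ 4 thr≤t)) ⟩
      2 ^ (6 * t) * ((2 * k) ^ (8 * t) * 4 ^ t)
        ≡⟨ cong (λ x → 2 ^ (6 * t) * (x * 4 ^ t)) (*-^-distrib 2 k (8 * t)) ⟩
      2 ^ (6 * t) * (2 ^ (8 * t) * k ^ (8 * t) * 4 ^ t)
        ≡⟨ cong (λ x → 2 ^ (6 * t) * (2 ^ (8 * t) * k ^ (8 * t) * x)) (^-*-assoc 2 2 t) ⟩
      2 ^ (6 * t) * (2 ^ (8 * t) * k ^ (8 * t) * 2 ^ (2 * t))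
        ≡⟨ regroup (2 ^ (6 * t)) (2 ^ (8 * t)) (k ^ (8 * t)) (2 ^ (2 * t)) ⟩
      2 ^ (6 * t) * 2 ^ (8 * t) * 2 ^ (2 * t) * k ^ (8 * t)
        ≡⟨ cong (_* k ^ (8 * t)) (trans (cong (_* 2 ^ (2 * t)) (sym (^-distribˡ-+-* 2 (6 * t) (8 * t))))
                                 (sym (^-distribˡ-+-* 2 (6 * t + 8 * t) (2 * t)))) ⟩
      2 ^ (6 * t + 8 * t + 2 * t) * k ^ (8 * t)
        ≡⟨ cong (λ e → 2 ^ e * k ^ (8 * t)) (sixteen t) ⟩
      2 ^ (2 * (8 * t)) * k ^ (8 * t)
        ≡⟨ cong (_* k ^ (8 * t)) (sym (^-*-assoc 2 2 (8 * t))) ⟩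
      4 ^ (8 * t) * k ^ (8 * t)
        ≡⟨ sym (*-^-distrib 4 k (8 * t)) ⟩
      (4 * k) ^ (8 * t) ∎
      where
      regroup : ∀ a b c d → a * (b * c * d) ≡ a * b * d * c
      regroup = solve-∀
      sixteen : ∀ t → 6 * t + 8 * t + 2 * t ≡ 2 * (8 * t)
      sixteen = solve-∀

  dimension-bound : ∀ n k t → 2 ^ t * k ≤ 32 * n → 3 * k < 2 * n →
                    2 ^ (8 * t * (4 * k)) * k ^ (320 * k) ≤ n ^ (320 * k)
  dimension-bound n k t 2^tk≤32n 3k<2n = begin
    2 ^ (8 * t * (4 * k)) * k ^ (320 * k)
      ≡⟨ cong₂ _*_ (trans (cong (2 ^_) (e₁ t k)) (sym (^-*-assoc 2 t (32 * k))))
                   (trans (cong (k ^_) (e₂ k)) (sym (^-*-assoc k 10 (32 * k)))) ⟩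
    (2 ^ t) ^ (32 * k) * (k ^ 10) ^ (32 * k)
      ≡⟨ sym (*-^-distrib (2 ^ t) (k ^ 10) (32 * k)) ⟩
    (2 ^ t * k ^ 10) ^ (32 * k)
      ≤⟨ ^-monoˡ-≤ (32 * k) base ⟩
    (n ^ 10) ^ (32 * k)
      ≡⟨ trans (^-*-assoc n 10 (32 * k)) (cong (n ^_) (sym (e₂ k))) ⟩
    n ^ (320 * k) ∎
    where
    open ≤-Reasoning
    e₁ : ∀ t k → 8 * t * (4 * k) ≡ t * (32 * k)
    e₁ = solve-∀
    e₂ : ∀ k → 320 * k ≡ 10 * (32 * k)
    e₂ = solve-∀
    -- (3k)^9 < (2n)^9 gives 32 k^9 ≤ n^9, since 32 · 2^9 ≤ 3^9
    k^9 : 32 * k ^ 9 ≤ n ^ 9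
    k^9 = *-cancelˡ-≤ 512 (begin
      512 * (32 * k ^ 9)   ≡⟨ sym (*-assoc 512 32 (k ^ 9)) ⟩
      16384 * k ^ 9        ≤⟨ *-monoˡ-≤ (k ^ 9) (≤ᵇ⇒≤ 16384 19683 _) ⟩
      19683 * k ^ 9        ≡⟨ sym (*-^-distrib 3 k 9) ⟩
      (3 * k) ^ 9          ≤⟨ ^-monoˡ-≤ 9 (<⇒≤ 3k<2n) ⟩
      (2 * n) ^ 9          ≡⟨ *-^-distrib 2 n 9 ⟩
      512 * n ^ 9          ∎)
    base : 2 ^ t * k ^ 10 ≤ n ^ 10
    base = begin
      2 ^ t * k ^ 10        ≡⟨ sym (*-assoc (2 ^ t) k (k ^ 9)) ⟩
      (2 ^ t * k) * k ^ 9   ≤⟨ *-monoˡ-≤ (k ^ 9) 2^tk≤32n ⟩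
      32 * n * k ^ 9        ≡⟨ shuffle n (k ^ 9) ⟩
      n * (32 * k ^ 9)      ≤⟨ *-monoʳ-≤ n k^9 ⟩
      n * n ^ 9             ∎
      where
      shuffle : ∀ n y → 32 * n * y ≡ n * (32 * y)
      shuffle = solve-∀

-- The code for 3k < 2n: a random block code, derandomised by counting.
module LargeCase (n k : ℕ) (2≤k : 2 ≤ k) (k≤n : k ≤ n) (3k<2n : 3 * k < 2 * n) where

  open import Data.Nat using (zero; suc; _+_; _∸_; _^_; z≤n; s≤s; _≤?_; NonZero; >-nonZero)
  open import Data.Nat.Properties
  open import Data.Nat.DivMod using (_/_; _%_; m≡m%n+[m/n]*n; m%n<n)
  open import Data.Nat.Tactic.RingSolver using (solve-∀)
  open import Data.Nat.Combinatorics using (_C_)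
  open import Data.Bool using (Bool; true; false; not; _∧_)
  open import Data.Fin using (Fin; zero; suc; fromℕ<)
  open import Data.Fin.Subset using (Subset; _∈_; _∉_; _∪_; ∣_∣; ⊥)
  open import Data.Fin.Subset.Properties using (x∈p∪q⁺)
  open import Data.Vec using (Vec; lookup; replicate; concat; tabulate)
  open import Data.Vec.Properties using (lookup∘tabulate; []=⇒lookup; lookup⇒[]=)
  open import Data.List using (allFin)
  open import Data.List.Properties using (length-tabulate)
  open import Data.Product using (Σ; _×_; _,_; proj₁; proj₂)
  open import Data.Sum using (inj₁; inj₂)
  open import Relation.Nullary using (yes; no; contradiction)
  open import Relation.Binary.PropositionalEquality
  open import Defs using (hamming)
  open FiniteSums using (∑; length-vectors)
  open SubsetCounting using (𝟙; subset-of-size; nonempty)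
  open UnionBound using (module Counting)
  open BlockCode
  open NearRows using (near; misses≤⇒near; rows; near-count)
  open Separations using (Separation; NNCode; separation⇒guarantee; 4k∸3≡1+4[k∸1])
  open Parameters using (power-between; union-bound-inequality; dimension-bound)

  1≤k : 1 ≤ k
  1≤k = ≤-trans (s≤s z≤n) 2≤k

  -- the scale t with 16n ≤ 2^t·k ≤ 32n, i.e. 2^t ≈ 16n/k (opaque: only these bounds are used)
  opaque
    scale : Σ ℕ λ t → 16 * n ≤ 2 ^ t * k × 2 ^ t * k ≤ 2 * (16 * n)
    scale = power-between (16 * n) k 1≤k (≤-trans k≤n (m≤m+n n (15 * n)))

  t : ℕ
  t = proj₁ scale

  16n≤2^tk : 16 * n ≤ 2 ^ t * k
  16n≤2^tk = proj₁ (proj₂ scale)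

  2^tk≤32n : 2 ^ t * k ≤ 32 * n
  2^tk≤32n = subst (2 ^ t * k ≤_) (sym (*-assoc 2 16 n)) (proj₂ (proj₂ scale))

  1≤t : 1 ≤ t
  1≤t = positive t 16n≤2^tk
    where
    positive : ∀ t → 16 * n ≤ 2 ^ t * k → 1 ≤ t
    positive zero    16n≤k = contradiction (≤-trans 16n≤k (≤-trans (≤-reflexive (*-identityˡ k)) k≤n)) (<⇒≱ n<16n)
      where
      n<16n : n < 16 * n
      n<16n = subst (n <_) (*-comm n 16) (m<m*n n 16 {{>-nonZero (≤-trans 1≤k k≤n)}} (≤ᵇ⇒≤ 2 16 _))
    positive (suc _) _     = s≤s z≤n

  -- Rows have L = 8t letters from an alphabet of B = 4k letters; a row is near a query when it
  -- misses at most thr = t - 1 of its blocks.  A bad pair consists of a k-set I and s = ⌊k/2⌋+1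
  -- rows outside I that are all near the query of I.
  L B thr s : ℕ
  L   = 8 * t
  B   = 4 * k
  thr = t ∸ 1
  s   = suc (k / 2)

  k≡[k%2]+2[k/2] : k ≡ k % 2 + 2 * (k / 2)
  k≡[k%2]+2[k/2] = trans (m≡m%n+[m/n]*n k 2) (cong (k % 2 +_) (*-comm (k / 2) 2))

  k≤2s : k ≤ 2 * s
  k≤2s = begin
    k                    ≡⟨ k≡[k%2]+2[k/2] ⟩
    k % 2 + 2 * (k / 2)  ≤⟨ +-monoˡ-≤ (2 * (k / 2)) (≤-pred (m%n<n k 2)) ⟩
    1 + 2 * (k / 2)      ≤⟨ +-monoˡ-≤ (2 * (k / 2)) (≤ᵇ⇒≤ 1 2 _) ⟩
    2 + 2 * (k / 2)      ≡⟨ sym (*-suc 2 (k / 2)) ⟩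
    2 * s                ∎
    where
    open ≤-Reasoning

  2[k/2]≤k : 2 * (k / 2) ≤ k
  2[k/2]≤k = subst (2 * (k / 2) ≤_) (sym k≡[k%2]+2[k/2]) (m≤n+m (2 * (k / 2)) (k % 2))

  empty : Query B L
  empty = replicate L ⊥

  open Counting (rows B L) insert (λ Q r → 𝟙 (near thr r Q))

  N : ℕ
  N = (2 * k) ^ L * 4 ^ thr

  R≡[4k]^L : R ≡ (4 * k) ^ L
  R≡[4k]^L = trans (length-vectors (allFin B) L) (cong (_^ L) (length-tabulate (λ x → x)))

  instance
    R≢0 : NonZero R
    R≢0 = subst NonZero (sym R≡[4k]^L) (m^n≢0 (4 * k) L {{>-nonZero (≤-trans 1≤k (m≤n*m k 4))}})

  -- the queries of k-sets have blocks of size at most k, so few rows are near them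
  near-bound : ∀ (I : Subset n) → ∣ I ∣ ≡ k → ∀ h →
               ∑ (rows B L) (λ r → 𝟙 (near thr r (query empty I h))) ≤ N
  near-bound I ∣I∣≡k h =
    near-count ≤-refl (query empty I h)
      (subst (λ m → BlocksAtMost m (query empty I h)) ∣I∣≡k (blocks-query empty I h blocks-empty)) thr

  -- a configuration of rows without bad pairs
  -- (opaque: its value is the result of an exhaustive search and must never be unfolded)
  opaque
    good : Σ (Vec (Row B L) n) λ h → ∀ (I J : Subset n) → ∣ I ∣ ≡ k → ∣ J ∣ ≡ s →
             event I J h (query empty I h) ≡ 0
    good = good-configuration empty k s (replicate L (fromℕ< 0<B)) N near-bound
      (subst (λ r → (n C k) * (n C s) * N ^ s < r ^ s) (sym R≡[4k]^L)
        (union-bound-inequality n k s t thr 16n≤2^tk k≤2s (s≤s z≤n) 1≤t 1≤k (m∸n≤m t 1)))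
      where
      0<B : 0 < B
      0<B = ≤-trans 1≤k (m≤n*m k 4)

  h : Vec (Row B L) n
  h = proj₁ good

  points : Fin n → Vec Bool (L * B)
  points i = encode (lookup h i)

  module _ (I : Subset n) (∣I∣≡k : ∣ I ∣ ≡ k) where

    Q : Query B L
    Q = query empty I h

    miss : Fin n → ℕ
    miss i = misses (lookup h i) Q

    X : Subset n
    X = tabulate (λ j → not (lookup I j) ∧ near thr (lookup h j) Q)

    radius : ℕ
    radius = size Q ∸ L

    L≤size : L ≤ size Q
    L≤size with nonempty I (subst (1 ≤_) (sym ∣I∣≡k) 1≤k)
    ... | i , i∈I = ≤-trans (m≤n+m L (hamming (points i) (concat Q))) (≤-reflexive (begin
      hamming (points i) (concat Q) + L   ≡⟨ distance-formula (lookup h i) Q ⟩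
      size Q + 2 * miss i                 ≡⟨ cong (λ m → size Q + 2 * m) (misses-member empty I h i∈I) ⟩
      size Q + 0                          ≡⟨ +-identityʳ (size Q) ⟩
      size Q                              ∎))
      where open ≡-Reasoning

    distance : ∀ i → hamming (points i) (concat Q) ≡ radius + 2 * miss i
    distance i = +-cancelʳ-≡ L _ _ (begin
      hamming (points i) (concat Q) + L   ≡⟨ distance-formula (lookup h i) Q ⟩
      size Q + 2 * miss i                 ≡⟨ cong (_+ 2 * miss i) (sym (m∸n+n≡m L≤size)) ⟩
      radius + L + 2 * miss i             ≡⟨ +-assoc radius L (2 * miss i) ⟩
      radius + (L + 2 * miss i)           ≡⟨ cong (radius +_) (+-comm L (2 * miss i)) ⟩
      radius + (2 * miss i + L)           ≡⟨ sym (+-assoc radius (2 * miss i) L) ⟩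
      radius + 2 * miss i + L             ∎)
      where open ≡-Reasoning

    inside : ∀ i → i ∈ I → hamming (points i) (concat Q) ≤ radius
    inside i i∈I = ≤-reflexive (trans (distance i)
      (trans (cong (λ m → radius + 2 * m) (misses-member empty I h i∈I)) (+-identityʳ radius)))

    X-members : ∀ j → j ∈ X → j ∉ I × 𝟙 (near thr (lookup h j) Q) ≡ 1
    X-members j j∈X with split (lookup I j) _ (trans (sym (lookup∘tabulate _ j)) ([]=⇒lookup j∈X))
      where
      split : ∀ a b → not a ∧ b ≡ true → a ≡ false × b ≡ true
      split false true _ = refl , refl
    ... | I[j]≡false , near≡true =
      (λ j∈I → contradiction (trans (sym ([]=⇒lookup j∈I)) I[j]≡false) λ ()) , cong 𝟙 near≡true

    -- at most k/2 rows outside I are near the query of I: otherwise they would contain a bad pair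
    extra-small : 2 * ∣ X ∣ ≤ k
    extra-small with ∣ X ∣ ≤? k / 2
    ... | yes ∣X∣≤k/2 = ≤-trans (*-monoʳ-≤ 2 ∣X∣≤k/2) 2[k/2]≤k
    ... | no  ∣X∣≰k/2 with subset-of-size X s (≰⇒> ∣X∣≰k/2)
    ...   | J , J⊆X , ∣J∣≡s = contradiction
            (trans (sym (event-one I J h Q (λ j j∈J → X-members j (J⊆X j∈J)))) (proj₂ good I J ∣I∣≡k ∣J∣≡s))
            λ ()

    ∉⇒lookup-false : ∀ {m} (P : Subset m) i → i ∉ P → lookup P i ≡ false
    ∉⇒lookup-false P i i∉P with lookup P i in P[i]
    ... | true  = contradiction (lookup⇒[]= i P P[i]) i∉P
    ... | false = refl

    far : ∀ i → i ∉ I ∪ X → t ≤ miss i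
    far i i∉I∪X with near thr (lookup h i) Q in near[i]
    ... | true  = contradiction (x∈p∪q⁺ (inj₂ (lookup⇒[]= i X (begin
        lookup X i                                             ≡⟨ lookup∘tabulate _ i ⟩
        not (lookup I i) ∧ near thr (lookup h i) Q             ≡⟨ cong₂ (λ a b → not a ∧ b) I[i]≡false near[i] ⟩
        true                                                   ∎)))) i∉I∪X
      where
      open ≡-Reasoning
      I[i]≡false = ∉⇒lookup-false I i (λ i∈I → i∉I∪X (x∈p∪q⁺ (inj₁ i∈I)))
    ... | false = subst (_≤ miss i) (trans (+-comm 1 thr) (m∸n+n≡m 1≤t))
        (≰⇒> (λ miss≤thr → contradiction (trans (sym (misses≤⇒near thr (lookup h i) Q miss≤thr)) near[i]) λ ()))

    -- the radius is at most L·(k - 1) = 4(k-1) · 2t, as the query blocks have at most k letters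
    radius-bound : radius ≤ 4 * (k ∸ 1) * (2 * t)
    radius-bound = begin
      size Q ∸ L            ≤⟨ ∸-monoˡ-≤ L (size-bound Q (subst (λ m → BlocksAtMost m Q) ∣I∣≡k
                                                            (blocks-query empty I h blocks-empty))) ⟩
      L * k ∸ L             ≡⟨ cong (L * k ∸_) (sym (*-identityʳ L)) ⟩
      L * k ∸ L * 1         ≡⟨ sym (*-distribˡ-∸ L k 1) ⟩
      8 * t * (k ∸ 1)       ≡⟨ regroup t (k ∸ 1) ⟩
      4 * (k ∸ 1) * (2 * t) ∎
      where
      open ≤-Reasoning
      regroup : ∀ t m → 8 * t * m ≡ 4 * m * (2 * t)
      regroup = solve-∀

    separation : Separation k points I
    separation = record
      { centre      = concat Q
      ; radius      = radius
      ; extra       = X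
      ; extra-small = extra-small
      ; inside      = inside
      ; outside     = λ i i∉ → subst₂ (λ a b → radius * a ≤ 4 * (k ∸ 1) * b)
                        (sym (4k∸3≡1+4[k∸1] k 1≤k)) (sym (distance i))
                        (far-bound radius (miss i) (4 * (k ∸ 1))
                          (≤-trans radius-bound (*-monoʳ-≤ (4 * (k ∸ 1)) (*-monoʳ-≤ 2 (far i i∉)))))
      ; outside-pos = λ i i∉ → subst (0 <_) (sym (distance i))
                        (≤-trans (≤-trans 1≤t (far i i∉)) (≤-trans (m≤m+n (miss i) (miss i + 0))
                          (m≤n+m (2 * miss i) radius)))
      }
      where
      far-bound : ∀ r m K → r ≤ K * (2 * m) → r * suc K ≤ K * (r + 2 * m)
      far-bound r m K r≤ = begin
        r * suc K              ≡⟨ *-suc r K ⟩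
        r + r * K              ≡⟨ +-comm r (r * K) ⟩
        r * K + r              ≤⟨ +-monoʳ-≤ (r * K) r≤ ⟩
        r * K + K * (2 * m)    ≡⟨ cong (_+ K * (2 * m)) (*-comm r K) ⟩
        K * r + K * (2 * m)    ≡⟨ sym (*-distribˡ-+ K r (2 * m)) ⟩
        K * (r + 2 * m)        ∎
        where open ≤-Reasoning

  large-code : NNCode 320 n k
  large-code = L * B , dimension-bound n k t 2^tk≤32n 3k<2n , points ,
    λ I ∣I∣≡k → separation⇒guarantee points I ∣I∣≡k 1≤k (separation I ∣I∣≡k)

open Separations using (Separation; NNCode; separation⇒guarantee)

-- For k ≥ 2n/3 the trivial code in dimension 0 works: all points coincide with the query, and
-- the exceptional set is the complement of I, of size n - k ≤ k/2.
small-code : ∀ C n k → 1 ≤ k → k ≤ n → 2 * n ≤ 3 * k → NNCode C n k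
small-code C n k 1≤k k≤n 2n≤3k =
  0 , ≤-trans (≤-reflexive (*-identityˡ (k ^ (C * k)))) (^-monoˡ-≤ (C * k) k≤n) , points ,
  λ I ∣I∣≡k → separation⇒guarantee points I ∣I∣≡k 1≤k (separation I ∣I∣≡k)
  where
  open ≤-Reasoning
  points : Fin n → Vec Bool 0
  points _ = []
  covered : ∀ (I : Subset n) i → i ∈ I ∪ ∁ I
  covered I i = subst (i ∈_) (sym (p∪∁p≡⊤ I)) ∈⊤
  separation : ∀ I → ∣ I ∣ ≡ k → Separation k points I
  separation I ∣I∣≡k = record
    { centre      = []
    ; radius      = 0
    ; extra       = ∁ I
    ; extra-small = begin
        2 * ∣ ∁ I ∣        ≡⟨ cong (2 *_) (trans (∣∁p∣≡n∸∣p∣ I) (cong (n ∸_) ∣I∣≡k)) ⟩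
        2 * (n ∸ k)        ≡⟨ *-distribˡ-∸ 2 n k ⟩
        2 * n ∸ 2 * k      ≤⟨ ∸-monoˡ-≤ (2 * k) 2n≤3k ⟩
        k + 2 * k ∸ 2 * k  ≡⟨ m+n∸n≡m k (2 * k) ⟩
        k                  ∎
    ; inside      = λ _ _ → z≤n
    ; outside     = λ i i∉ → contradiction (covered I i) i∉
    ; outside-pos = λ i i∉ → contradiction (covered I i) i∉
    }

mainTheorem11 : Σ ℕ λ C → ∀ (n k : ℕ) → 2 ≤ k → k ≤ n →
    Σ ℕ λ d → ((2 ^ d) * (k ^ (C * k)) ≤ n ^ (C * k)) ×
    Σ (Fin n → Vec Bool d) λ p →
    ∀ (I : Subset n) → ∣ I ∣ ≡ k →
    Σ (Vec Bool d) λ q → Σ ℕ λ dI → Σ (Subset n) λ I′ →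
      (I ⊆ I′) × (2 * ∣ I′ ∣ ≤ 3 * k) ×
      (∀ i → i ∈ I → hamming (p i) q ≤ dI) ×
      (∀ i → i ∉ I′ → dI * (4 * k ∸ 3) ≤ (4 * (k ∸ 1)) * hamming (p i) q) ×
      (∀ (a b : ℕ) → 0 < b → a * (4 * (k ∸ 1)) < b * (4 * k ∸ 3) →
        ∀ (S : Subset n) → ValidNN a b k p q S →
        (S ⊆ I′) × (k ≤ 2 * ∣ S ∩ I ∣))
mainTheorem11 = 320 , code
  where
  code : ∀ n k → 2 ≤ k → k ≤ n → NNCode 320 n k
  code n k 2≤k k≤n with 2 * n ≤? 3 * k
  ... | yes 2n≤3k = small-code 320 n k (≤-trans (s≤s z≤n) 2≤k) k≤n 2n≤3k
  ... | no  2n≰3k = LargeCase.large-code n k 2≤k k≤n (≰⇒> 2n≰3k)
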